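{- For every integer $n\ge 0$, \[ \overline{p}_o(n)+2\sum_{k=1}^{\infty}(-1)^k\,\overline{p}_o(n-2k^2)=\begin{cases}2, & \text{if } n=m^2 \text{ for some integer } m\ge 1,\\ 1, & \text{if } n=0,\\ 0, & \text{otherwise}.\end{cases} \]
   Context: An overpartition of a nonnegative integer $n$ is a partition of $n$ in which the first occurrence of each part size may be overlined. $\overline{p}_o(n)$ denotes the number of overpartitions of $n$ into odd parts; equivalently $\sum_{n\ge0}\overline{p}_o(n)q^n=\frac{(-q;q^2)_\infty}{(q;q^2)_\infty}$, where $(a;q)_\infty=\prod_{k\ge1}(1-aq^{k-1})$. Convention: $\overline{p}_o(x)=0$ whenever $x$ is not a nonnegative integer. -}

module Defs where

open import Data.Nat using (ℕ; zero; suc; _+_; _*_; _∸_; _≤ᵇ_)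
open import Data.Bool using (if_then_else_)
open import Data.Integer as ℤ using (ℤ; +_)
open import Data.List using (List; map; sum; upTo)

sumFrom1 : ℕ → (ℕ → ℕ) → ℕ
sumFrom1 zero    f = 0
sumFrom1 (suc c) f = sumFrom1 c f + f (suc c)

-- opBounded n j = number of overpartitions of n into odd parts, all parts
-- belonging to {1, 3, ..., 2j-1}.  Recursion on the largest allowed part
-- size p = 2j+1: either p does not occur, or it occurs with multiplicity
-- m ≥ 1 (and then its first occurrence is overlined or not: factor 2).
opBounded : ℕ → ℕ → ℕ
opBounded zero    zero    = 1
opBounded (suc n) zero    = 0
opBounded n       (suc j) =
  opBounded n j
  + 2 * sumFrom1 n (λ m → if m * (2 * j + 1) ≤ᵇ n
                            then opBounded (n ∸ m * (2 * j + 1)) j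
                            else 0)

-- number of overpartitions of n into odd parts (every odd part is ≤ 2n-1
-- when n ≥ 1, so allowing parts 1,3,...,2n-1 covers all of them)
pbarO : ℕ → ℕ
pbarO n = opBounded n n

-- pbarO (n - x), with the convention pbarO(negative) = 0
pbarOShift : ℕ → ℕ → ℕ
pbarOShift n x = if x ≤ᵇ n then pbarO (n ∸ x) else 0

signPow : ℕ → ℤ
signPow zero    = + 1
signPow (suc k) = ℤ.- signPow k

-- Σ_{k=1}^{c} (-1)^k pbarO(n - 2k²); terms with k > n vanish since 2k² > n
altSum : ℕ → ℕ → ℤ
altSum n zero    = + 0
altSum n (suc c) = altSum n c ℤ.+ signPow (suc c) ℤ.* (+ pbarOShift n (2 * (suc c * suc c)))

lhs : ℕ → ℤ
lhs n = + pbarO n ℤ.+ + 2 ℤ.* altSum n n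

module Submission where

-- With T(q) = Σ p̄ₒ(n) qⁿ = (-q;q²)∞/(q;q²)∞ and θ(q) = Σ_{k∈ℤ} q^(k²), the left-hand side is
-- the coefficient of qⁿ in θ(-q²)·T(q) and the right-hand side is that of θ(q).  By Jacobi's
-- triple product θ(q) = (q²;q²)∞(-q;q²)∞² and θ(-q²) = (q⁴;q⁴)∞(q²;q⁴)∞², and the identities
-- (q⁴;q⁴)∞(q²;q⁴)∞ = (q²;q²)∞ and (q²;q⁴)∞ = (q;q²)∞(-q;q²)∞ turn θ(-q²)·T(q) into θ(q).
-- Everything is done modulo q^(N+1) with finite products: the coefficient of z^t in
-- Π_{i<j} (z + q^(2i+1))(1 + z q^(2i+1)) is q^((t-j)²) times a Gaussian binomial in q², and for
-- j = 2N and |t - j| ≤ N that binomial times (q²;q²)_{2j} is 1 modulo q^(N+1).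

open import Algebra.Bundles using (CommutativeRing)
open import Algebra.Core using (Op₁; Op₂)
open import Algebra.Structures using (IsCommutativeRing)
open import Data.Bool using (if_then_else_)
open import Data.Empty using (⊥-elim)
open import Data.Integer as ℤ using (ℤ)
import Data.Integer.Properties as ℤ
import Data.Integer.Tactic.RingSolver as ℤ-Solver
open import Data.List using (List; []; _∷_)
open import Data.Nat as ℕ using (ℕ; zero; suc; _∸_; _≤_; _<_; z≤n; s≤s; ∣_-_∣; NonZero)
import Data.Nat.Properties as ℕ
import Data.Nat.Tactic.RingSolver as ℕ-Solver
open import Data.Product using (_,_)
open import Data.Sum using (inj₁; inj₂)
open import Level using (0ℓ)
open import Relation.Binary.Definitions using (tri<; tri≈; tri>)
open import Relation.Binary.PropositionalEquality as ≡ using (_≡_; _≢_; _≗_; cong; cong₂)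
open import Relation.Nullary using (yes; no)

module IntegerSolver {c ℓ} (R : CommutativeRing c ℓ) where
  open import Algebra.Solver.Ring.AlmostCommutativeRing using (fromCommutativeRing; _-Raw-AlmostCommutative⟶_)
  open import Data.Integer using (+_; -[1+_]; _⊖_; _◃_; sign; ∣_∣)
  open import Data.Maybe using (Maybe; just; nothing)
  open import Data.Sign as Sign using (Sign)
  open CommutativeRing R
  open import Algebra.Properties.Semiring.Mult.TCOptimised semiring using (_×_; 1+×; ×-homo-+; ×1-homo-*)
  open import Algebra.Properties.Ring ring
    using (-‿distribˡ-*; -‿distribʳ-*; -‿involutive; -0#≈0#; -‿+-comm)
  open import Relation.Binary.Reasoning.Setoid setoid

  -- With the TC-optimised multiplication 1 × x reduces to x, so the solver constant :1
  -- evaluates to 1# definitionally.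
  fromℕ : ℕ → Carrier
  fromℕ n = n × 1#

  fromℤ : ℤ → Carrier
  fromℤ (+ n)      = fromℕ n
  fromℤ -[1+ n ]   = - fromℕ (suc n)

  signed : Sign → Carrier → Carrier
  signed Sign.+ x = x
  signed Sign.- x = - x

  signed-cong : ∀ s {x y} → x ≈ y → signed s x ≈ signed s y
  signed-cong Sign.+ x≈y = x≈y
  signed-cong Sign.- x≈y = -‿cong x≈y

  signed-* : ∀ s t x y → signed (s Sign.* t) (x * y) ≈ signed s x * signed t y
  signed-* Sign.+ Sign.+ x y = refl
  signed-* Sign.+ Sign.- x y = -‿distribʳ-* x y
  signed-* Sign.- Sign.+ x y = -‿distribˡ-* x y
  signed-* Sign.- Sign.- x y = begin
    x * y             ≈⟨ -‿involutive (x * y) ⟨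
    - - (x * y)       ≈⟨ -‿cong (-‿distribʳ-* x y) ⟩
    - (x * - y)       ≈⟨ -‿distribˡ-* x (- y) ⟩
    - x * - y         ∎

  fromℤ-sign : ∀ i → fromℤ i ≈ signed (sign i) (fromℕ ∣ i ∣)
  fromℤ-sign (+ n)    = refl
  fromℤ-sign -[1+ n ] = refl

  fromℤ-◃ : ∀ s n → fromℤ (s ◃ n) ≈ signed s (fromℕ n)
  fromℤ-◃ Sign.- zero    = sym -0#≈0#
  fromℤ-◃ Sign.+ zero    = refl
  fromℤ-◃ Sign.- (suc n) = refl
  fromℤ-◃ Sign.+ (suc n) = refl

  fromℕ-suc : ∀ n → fromℕ (suc n) ≈ 1# + fromℕ n
  fromℕ-suc n = 1+× n 1#

  fromℤ-⊖ : ∀ m n → fromℤ (m ⊖ n) ≈ fromℕ m - fromℕ n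
  fromℤ-⊖ m       zero    = sym (trans (+-congˡ -0#≈0#) (+-identityʳ _))
  fromℤ-⊖ zero    (suc n) = sym (+-identityˡ _)
  fromℤ-⊖ (suc m) (suc n) = begin
    fromℤ (suc m ⊖ suc n)               ≡⟨ ≡.cong fromℤ (ℤ.[1+m]⊖[1+n]≡m⊖n m n) ⟩
    fromℤ (m ⊖ n)                       ≈⟨ fromℤ-⊖ m n ⟩
    fromℕ m - fromℕ n                   ≈⟨ +-congˡ (+-identityˡ _) ⟨
    fromℕ m + (0# - fromℕ n)            ≈⟨ +-congˡ (+-congʳ (-‿inverseʳ 1#)) ⟨
    fromℕ m + ((1# - 1#) - fromℕ n)     ≈⟨ +-congˡ (+-assoc _ _ _) ⟩
    fromℕ m + (1# + (- 1# - fromℕ n))   ≈⟨ +-assoc _ _ _ ⟨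
    (fromℕ m + 1#) + (- 1# - fromℕ n)   ≈⟨ +-cong (+-comm _ _) (-‿+-comm _ _) ⟩
    (1# + fromℕ m) - (1# + fromℕ n)     ≈⟨ +-cong (fromℕ-suc m) (-‿cong (fromℕ-suc n)) ⟨
    fromℕ (suc m) - fromℕ (suc n)       ∎

  fromℤ-+ : ∀ i j → fromℤ (i ℤ.+ j) ≈ fromℤ i + fromℤ j
  fromℤ-+ (+ m)    (+ n)    = ×-homo-+ 1# m n
  fromℤ-+ (+ m)    -[1+ n ] = fromℤ-⊖ m (suc n)
  fromℤ-+ -[1+ m ] (+ n)    = trans (fromℤ-⊖ n (suc m)) (+-comm _ _)
  fromℤ-+ -[1+ m ] -[1+ n ] = begin
    - fromℕ (suc (suc (m ℕ.+ n)))     ≡⟨ ≡.cong (λ k → - fromℕ (suc k)) (ℕ.+-suc m n) ⟨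
    - fromℕ (suc m ℕ.+ suc n)         ≈⟨ -‿cong (×-homo-+ 1# (suc m) (suc n)) ⟩
    - (fromℕ (suc m) + fromℕ (suc n)) ≈⟨ -‿+-comm _ _ ⟨
    - fromℕ (suc m) - fromℕ (suc n)   ∎

  fromℤ-* : ∀ i j → fromℤ (i ℤ.* j) ≈ fromℤ i * fromℤ j
  fromℤ-* i j = begin
    fromℤ (i ℤ.* j)                                   ≈⟨ fromℤ-◃ (s Sign.* t) (∣ i ∣ ℕ.* ∣ j ∣) ⟩
    signed (s Sign.* t) (fromℕ (∣ i ∣ ℕ.* ∣ j ∣))     ≈⟨ signed-cong (s Sign.* t) (×1-homo-* ∣ i ∣ ∣ j ∣) ⟩
    signed (s Sign.* t) (fromℕ ∣ i ∣ * fromℕ ∣ j ∣)   ≈⟨ signed-* s t _ _ ⟩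
    signed s (fromℕ ∣ i ∣) * signed t (fromℕ ∣ j ∣)   ≈⟨ *-cong (fromℤ-sign i) (fromℤ-sign j) ⟨
    fromℤ i * fromℤ j                                 ∎
    where
    s t : Sign
    s = sign i
    t = sign j

  fromℤ-neg : ∀ i → fromℤ (ℤ.- i) ≈ - fromℤ i
  fromℤ-neg (+ zero)  = sym -0#≈0#
  fromℤ-neg (+ suc n) = refl
  fromℤ-neg -[1+ n ]  = sym (-‿involutive _)

  fromℤ-homomorphism : ℤ.+-*-rawRing -Raw-AlmostCommutative⟶ fromCommutativeRing R
  fromℤ-homomorphism = record
    { ⟦_⟧ = fromℤ ; +-homo = fromℤ-+ ; *-homo = fromℤ-* ; -‿homo = fromℤ-neg
    ; 0-homo = refl ; 1-homo = refl }

  fromℤ-≟ : ∀ i j → Maybe (fromℤ i ≈ fromℤ j)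
  fromℤ-≟ i j with i ℤ.≟ j
  ... | yes ≡.refl = just refl
  ... | no _       = nothing

  open import Algebra.Solver.Ring ℤ.+-*-rawRing (fromCommutativeRing R) fromℤ-homomorphism fromℤ-≟ public
    using (solve; _:=_; Polynomial; con; _:+_; _:*_; _:-_; :-_)

  :1 : ∀ {n} → Polynomial n
  :1 = con (+ 1)

-- Defined from the bare operations, so that the same terms serve every truncation of the
-- power series ring (see Precision).
module RawRingDefinitions {c} {A : Set c} (add mul : Op₂ A) (neg : Op₁ A) (0# 1# : A) where
  infix  8 -_
  infixr 8 _^_
  infixl 7 _*_
  infixl 6 _+_ _-_

  _+_ _*_ _-_ : Op₂ A
  _+_ = add
  _*_ = mul
  x - y = x + neg y

  -_ : Op₁ A
  -_ = neg

  2# : A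
  2# = 1# + 1#

  _^_ : A → ℕ → A
  x ^ zero  = 1#
  x ^ suc n = x * x ^ n

  ∑ : ℕ → (ℕ → A) → A
  ∑ zero    f = 0#
  ∑ (suc n) f = f 0 + ∑ n (λ t → f (suc t))

  module JacobiTriple (q : A) where
    odd : ℕ → A
    odd i = q ^ suc (2 ℕ.* i)

    product : A → ℕ → A
    product z zero    = 1#
    product z (suc j) = (z + odd j) * (1# + z * odd j) * product z j

    -- coeff j t is the coefficient of z^t in product z j (product-expansion).
    coeff : ℕ → ℕ → A
    coeff zero    zero          = 1#
    coeff zero    (suc t)       = 0#
    coeff (suc j) zero          = odd j * coeff j 0
    coeff (suc j) (suc zero)    = (1# + odd j * odd j) * coeff j 0 + odd j * coeff j 1
    coeff (suc j) (suc (suc t)) =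
      (1# + odd j * odd j) * coeff j (suc t) + odd j * (coeff j (suc (suc t)) + coeff j t)

    -- In q-Pochhammer notation evenPoch t = (q²;q²)_t, evenPochFrom t n = (q^(2t+2);q²)_n,
    -- oddPoch⁻ j = (q;q²)_j and oddPoch⁺ j = (-q;q²)_j.
    evenPoch : ℕ → A
    evenPoch zero    = 1#
    evenPoch (suc t) = (1# - q ^ suc t * q ^ suc t) * evenPoch t

    evenPochFrom : ℕ → ℕ → A
    evenPochFrom t zero    = 1#
    evenPochFrom t (suc n) = (1# - q ^ suc (t ℕ.+ n) * q ^ suc (t ℕ.+ n)) * evenPochFrom t n

    -- Π_{i<t} (1 - q^(2(m-i))); through truncated subtraction it vanishes when t > m.
    descending : ℕ → ℕ → A
    descending m zero    = 1#
    descending m (suc t) = (1# - q ^ (m ∸ t) * q ^ (m ∸ t)) * descending m t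

    oddPoch⁻ oddPoch⁺ : ℕ → A
    oddPoch⁻ zero    = 1#
    oddPoch⁻ (suc j) = (1# - odd j) * oddPoch⁻ j
    oddPoch⁺ zero    = 1#
    oddPoch⁺ (suc j) = (1# + odd j) * oddPoch⁺ j

  thetaPartial : A → (ℕ → A) → ℕ → A
  thetaPartial z w zero    = 0#
  thetaPartial z w (suc k) = thetaPartial z w k + z ^ suc k * w (suc k)

module RingLemmas {c ℓ} (R : CommutativeRing c ℓ) where
  open import Data.Integer using (+_)
  open CommutativeRing R hiding (zero)
  open RawRingDefinitions _+_ _*_ -_ 0# 1# public using (2#; _^_; ∑; module JacobiTriple; thetaPartial)
  open IntegerSolver R public
  open import Relation.Binary.Reasoning.Setoid setoid

  ^-cong : ∀ {x y} n → x ≈ y → x ^ n ≈ y ^ n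
  ^-cong zero    x≈y = refl
  ^-cong (suc n) x≈y = *-cong x≈y (^-cong n x≈y)

  ^-congʳ : ∀ x {m n} → m ≡ n → x ^ m ≈ x ^ n
  ^-congʳ x ≡.refl = refl

  ^-+ : ∀ x m n → x ^ (m ℕ.+ n) ≈ x ^ m * x ^ n
  ^-+ x zero    n = sym (*-identityˡ _)
  ^-+ x (suc m) n = trans (*-congˡ (^-+ x m n)) (sym (*-assoc _ _ _))

  ^-distrib-* : ∀ x y n → (x * y) ^ n ≈ x ^ n * y ^ n
  ^-distrib-* x y zero    = sym (*-identityˡ _)
  ^-distrib-* x y (suc n) = trans (*-congˡ (^-distrib-* x y n))
    (solve 4 (λ x y a b → (x :* y) :* (a :* b) := (x :* a) :* (y :* b)) refl x y (x ^ n) (y ^ n))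

  ^-square : ∀ x n → (x * x) ^ n ≈ x ^ (2 ℕ.* n)
  ^-square x n = trans (^-distrib-* x x n) (trans (sym (^-+ x n n)) (^-congʳ x (≡.cong (n ℕ.+_) (≡.sym (ℕ.+-identityʳ n)))))

  total : List ℕ → ℕ
  total []           = 0
  total (e ∷ [])     = e
  total (e ∷ f ∷ es) = e ℕ.+ total (f ∷ es)

  powers : Carrier → List ℕ → Carrier
  powers x []           = 1#
  powers x (e ∷ [])     = x ^ e
  powers x (e ∷ f ∷ es) = x ^ e * powers x (f ∷ es)

  ^-split : ∀ x {e} es → e ≡ total es → x ^ e ≈ powers x es
  ^-split x []           ≡.refl = refl
  ^-split x (e ∷ [])     ≡.refl = refl
  ^-split x (e ∷ f ∷ es) ≡.refl = trans (^-+ x e (total (f ∷ es))) (*-congˡ (^-split x (f ∷ es) ≡.refl))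

  1^ : ∀ n → 1# ^ n ≈ 1#
  1^ zero    = refl
  1^ (suc n) = trans (*-identityˡ _) (1^ n)

  ^-square-one : ∀ {z} → z * z ≈ 1# → ∀ n → z ^ n * z ^ n ≈ 1#
  ^-square-one {z} zz n = trans (sym (^-distrib-* z z n)) (trans (^-cong n zz) (1^ n))

  ∑-cong : ∀ n {f g} → (∀ t → t < n → f t ≈ g t) → ∑ n f ≈ ∑ n g
  ∑-cong zero    f≈g = refl
  ∑-cong (suc n) f≈g = +-cong (f≈g 0 (s≤s z≤n)) (∑-cong n (λ t t<n → f≈g (suc t) (s≤s t<n)))

  ∑-+ : ∀ n f g → ∑ n (λ t → f t + g t) ≈ ∑ n f + ∑ n g
  ∑-+ zero    f g = sym (+-identityˡ _)
  ∑-+ (suc n) f g = trans (+-congˡ (∑-+ n _ _))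
    (solve 4 (λ a b c d → (a :+ b) :+ (c :+ d) := (a :+ c) :+ (b :+ d)) refl (f 0) (g 0) _ _)

  ∑-*ˡ : ∀ n a f → ∑ n (λ t → a * f t) ≈ a * ∑ n f
  ∑-*ˡ zero    a f = sym (zeroʳ a)
  ∑-*ˡ (suc n) a f = trans (+-congˡ (∑-*ˡ n a _)) (sym (distribˡ _ _ _))

  ∑-0 : ∀ n f → (∀ t → f t ≈ 0#) → ∑ n f ≈ 0#
  ∑-0 zero    f f≈0 = refl
  ∑-0 (suc n) f f≈0 = trans (+-cong (f≈0 0) (∑-0 n _ (λ t → f≈0 (suc t)))) (+-identityˡ _)

  ∑-snoc : ∀ n f → ∑ (suc n) f ≈ ∑ n f + f n
  ∑-snoc zero    f = trans (+-identityʳ _) (sym (+-identityˡ _))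
  ∑-snoc (suc n) f = trans (+-congˡ (∑-snoc n _)) (sym (+-assoc _ _ _))

  1-cong : ∀ {x y} → x ≈ y → 1# - x ≈ 1# - y
  1-cong x≈y = +-congˡ (-‿cong x≈y)

  x≈1⇒[1-x]*y≈0 : ∀ {x} → x ≈ 1# → ∀ y → (1# - x) * y ≈ 0#
  x≈1⇒[1-x]*y≈0 x≈1 y = trans (*-congʳ (trans (1-cong x≈1) (-‿inverseʳ 1#))) (zeroˡ y)

  module JacobiTripleProduct (q : Carrier) where
    open JacobiTriple q public
    open import Algebra.Properties.CommutativeSemigroup *-commutativeSemigroup using (x∙yz≈y∙xz)

    descending-suc : ∀ m t → descending (suc m) (suc t) ≈ (1# - q ^ suc m * q ^ suc m) * descending m t
    descending-suc m zero    = refl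
    descending-suc m (suc t) = trans (*-congˡ (descending-suc m t)) (x∙yz≈y∙xz _ _ _)

    descending-vanishes : ∀ m t → m < t → descending m t ≈ 0#
    descending-vanishes m (suc t) (s≤s m≤t) = x≈1⇒[1-x]*y≈0 (trans (*-cong q^0 q^0) (*-identityˡ 1#)) _
      where
      q^0 : q ^ (m ∸ t) ≈ q ^ 0
      q^0 = ^-congʳ q (ℕ.m≤n⇒m∸n≡0 m≤t)

    evenPoch-+ : ∀ t n → evenPoch (t ℕ.+ n) ≈ evenPoch t * evenPochFrom t n
    evenPoch-+ t zero    = trans (reflexive (≡.cong evenPoch (ℕ.+-identityʳ t))) (sym (*-identityʳ _))
    evenPoch-+ t (suc n) = trans (reflexive (≡.cong evenPoch (ℕ.+-suc t n)))
      (trans (*-congˡ (evenPoch-+ t n)) (x∙yz≈y∙xz _ _ _))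

    product-expansion : ∀ z j L → suc (2 ℕ.* j) ≤ L → ∑ L (λ t → z ^ t * coeff j t) ≈ product z j
    product-expansion z zero    (suc L)       _ =
      trans (+-cong (*-identityˡ 1#) (∑-0 L _ (λ t → zeroʳ _))) (+-identityʳ 1#)
    product-expansion z (suc j) (suc (suc L)) (s≤s (s≤s 2j<L)) = begin
      1# * (y * d 0) + ((z * 1#) * ((1# + y * y) * d 0 + y * d 1) + ∑ L f)
        ≈⟨ +-congˡ (+-congˡ (trans (∑-cong L (λ t _ → split t)) (trans (∑-+ L _ _)
             (+-cong (∑-*ˡ L _ _) (trans (∑-+ L _ _) (+-cong (∑-*ˡ L _ _) (∑-*ˡ L _ _))))))) ⟩
      1# * (y * d 0) + ((z * 1#) * ((1# + y * y) * d 0 + y * d 1)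
        + ((1# + y * y) * z * S₁ + (y * S₂ + y * (z * z) * S₀)))
        ≈⟨ solve 7 (λ z y d₀ d₁ S₀ S₁ S₂ →
             :1 :* (y :* d₀) :+ ((z :* :1) :* ((:1 :+ y :* y) :* d₀ :+ y :* d₁)
               :+ ((:1 :+ y :* y) :* z :* S₁ :+ (y :* S₂ :+ y :* (z :* z) :* S₀)))
             := (z :+ z :* (y :* y)) :* (:1 :* d₀ :+ S₁) :+ y :* (:1 :* d₀ :+ ((z :* :1) :* d₁ :+ S₂))
                :+ y :* (z :* z) :* S₀)
           refl z y (d 0) (d 1) S₀ S₁ S₂ ⟩
      (z + z * (y * y)) * (1# * d 0 + S₁) + y * (1# * d 0 + ((z * 1#) * d 1 + S₂)) + y * (z * z) * S₀
        ≈⟨ +-cong (+-cong (*-congˡ (product-expansion z j (suc L) (ℕ.m≤n⇒m≤1+n 2j<L′)))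
                          (*-congˡ (product-expansion z j (suc (suc L)) (ℕ.m≤n⇒m≤1+n (ℕ.m≤n⇒m≤1+n 2j<L′)))))
                  (*-congˡ (product-expansion z j L 2j<L′)) ⟩
      (z + z * (y * y)) * P + y * P + y * (z * z) * P
        ≈⟨ solve 3 (λ z y P → (z :+ z :* (y :* y)) :* P :+ y :* P :+ y :* (z :* z) :* P
                              := (z :+ y) :* (:1 :+ z :* y) :* P) refl z y P ⟩
      product z (suc j) ∎
      where
      y P : Carrier
      y = odd j
      P = product z j
      d : ℕ → Carrier
      d = coeff j
      2j<L′ : suc (2 ℕ.* j) ≤ L
      2j<L′ = ≡.subst (_≤ L) (ℕ.+-suc j (j ℕ.+ 0)) 2j<L
      f : ℕ → Carrier
      f t = z * (z * z ^ t) * ((1# + y * y) * d (suc t) + y * (d (suc (suc t)) + d t))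
      S₀ S₁ S₂ : Carrier
      S₀ = ∑ L (λ t → z ^ t * d t)
      S₁ = ∑ L (λ t → z ^ suc t * d (suc t))
      S₂ = ∑ L (λ t → z ^ suc (suc t) * d (suc (suc t)))
      split : ∀ t → f t ≈ (1# + y * y) * z * (z ^ suc t * d (suc t))
                           + (y * (z ^ suc (suc t) * d (suc (suc t))) + y * (z * z) * (z ^ t * d t))
      split t = solve 6 (λ z y w a b c →
                  z :* (z :* w) :* ((:1 :+ y :* y) :* a :+ y :* (b :+ c))
                  := (:1 :+ y :* y) :* z :* ((z :* w) :* a) :+ (y :* ((z :* (z :* w)) :* b) :+ y :* (z :* z) :* (w :* c)))
                refl z y (z ^ t) (d (suc t)) (d (suc (suc t))) (d t)

    -- coeff-closed-form says coeff j s = q^((s-j)²) · [2j choose s]_{q²}; multiplying by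
    -- q^(2sj) keeps every exponent natural.
    twisted gaussian : ℕ → ℕ → Carrier
    twisted  j s = q ^ (2 ℕ.* s ℕ.* j) * (evenPoch s * coeff j s)
    gaussian j s = q ^ (s ℕ.* s ℕ.+ j ℕ.* j) * descending (2 ℕ.* j) s

    α β : ℕ → ℕ → Carrier
    α s j = q ^ s * q ^ s * q ^ (2 ℕ.* j) * (1# + odd j * odd j) * (1# - q ^ s * q ^ s)
    β s j = q ^ s * q ^ s * odd j

    γ : ℕ → ℕ → Carrier
    γ t j = q ^ (2 ℕ.+ t) * q ^ (2 ℕ.+ t) * q ^ (2 ℕ.* j) * q ^ (2 ℕ.* j) * odd j
            * (1# - q ^ (2 ℕ.+ t) * q ^ (2 ℕ.+ t)) * (1# - q ^ suc t * q ^ suc t)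

    -- twisted (suc j) arises from twisted j through multiplication by (z + odd j)(1 + z odd j);
    -- gaussian obeys the same recurrence by the q-Pascal rule (pascal-descending).
    nextRow : ℕ → (ℕ → Carrier) → ℕ → Carrier
    nextRow j u zero          = β 0 j * u 0
    nextRow j u (suc zero)    = α 1 j * u 0 + β 1 j * u 1
    nextRow j u (suc (suc t)) = α (2 ℕ.+ t) j * u (suc t) + β (2 ℕ.+ t) j * u (2 ℕ.+ t) + γ t j * u t

    nextRow-cong : ∀ j {u v} → (∀ s → u s ≈ v s) → ∀ s → nextRow j u s ≈ nextRow j v s
    nextRow-cong j u≈v zero          = *-congˡ (u≈v 0)
    nextRow-cong j u≈v (suc zero)    = +-cong (*-congˡ (u≈v 0)) (*-congˡ (u≈v 1))
    nextRow-cong j u≈v (suc (suc t)) =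
      +-cong (+-cong (*-congˡ (u≈v (suc t))) (*-congˡ (u≈v (2 ℕ.+ t)))) (*-congˡ (u≈v t))

    twisted-nextRow : ∀ j s → twisted (suc j) s ≈ nextRow j (twisted j) s
    twisted-nextRow j zero =
      solve 2 (λ y d → :1 :* (:1 :* (y :* d)) := :1 :* :1 :* y :* (:1 :* (:1 :* d))) refl (odd j) (coeff j 0)
    twisted-nextRow j (suc zero) = begin
      q ^ (2 ℕ.* suc j) * (E₁ * ((1# + y * y) * coeff j 0 + y * coeff j 1))
        ≈⟨ *-congʳ (^-split q (2 ∷ 2 ℕ.* j ∷ []) 2[1+j]) ⟩
      q ^ 2 * K * (E₁ * ((1# + y * y) * coeff j 0 + y * coeff j 1))
        ≈⟨ solve 4 (λ q K d₀ d₁ → let q¹ = q :* :1; y = q :* K; E₁ = (:1 :- q¹ :* q¹) :* :1 in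
             q :* q¹ :* K :* (E₁ :* ((:1 :+ y :* y) :* d₀ :+ y :* d₁))
             := q¹ :* q¹ :* K :* (:1 :+ y :* y) :* (:1 :- q¹ :* q¹) :* (:1 :* (:1 :* d₀))
                :+ q¹ :* q¹ :* y :* (K :* (E₁ :* d₁)))
           refl q K (coeff j 0) (coeff j 1) ⟩
      nextRow j (twisted j) 1 ∎
      where
      y K E₁ : Carrier
      y  = odd j
      K  = q ^ (2 ℕ.* j)
      E₁ = evenPoch 1
      2[1+j] : 2 ℕ.* suc j ≡ 2 ℕ.+ 2 ℕ.* j
      2[1+j] = ℕ-Solver.solve (j ∷ [])
    twisted-nextRow j (suc (suc t)) = begin
      q ^ (2 ℕ.* (2 ℕ.+ t) ℕ.* suc j) * (E₂ * ((1# + y * y) * d₁ + y * (d₂ + d₀)))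
        ≈⟨ *-congʳ (^-split q (2 ℕ.* t ℕ.* j ∷ 2 ℕ.* j ∷ 2 ℕ.* j ∷ 2 ℕ.+ t ∷ 2 ℕ.+ t ∷ []) 2[2+t][1+j]) ⟩
      Z * (K * (K * (q ^ (2 ℕ.+ t) * q ^ (2 ℕ.+ t)))) * (E₂ * ((1# + y * y) * d₁ + y * (d₂ + d₀)))
        ≈⟨ solve 8 (λ Z K A E q d₀ d₁ d₂ →
             let y = q :* K; B₁ = q :* A; B₂ = q :* (q :* A)
                 E₁ = (:1 :- B₁ :* B₁) :* E; E₂ = (:1 :- B₂ :* B₂) :* E₁ in
             Z :* (K :* (K :* (B₂ :* B₂))) :* (E₂ :* ((:1 :+ y :* y) :* d₁ :+ y :* (d₂ :+ d₀)))
             := B₂ :* B₂ :* K :* (:1 :+ y :* y) :* (:1 :- B₂ :* B₂) :* (Z :* K :* (E₁ :* d₁))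
                :+ B₂ :* B₂ :* y :* (Z :* (K :* K) :* (E₂ :* d₂))
                :+ B₂ :* B₂ :* K :* K :* y :* (:1 :- B₂ :* B₂) :* (:1 :- B₁ :* B₁) :* (Z :* (E :* d₀)))
           refl Z K (q ^ t) (evenPoch t) q d₀ d₁ d₂ ⟩
      α (2 ℕ.+ t) j * (Z * K * (E₁ * d₁)) + β (2 ℕ.+ t) j * (Z * (K * K) * (E₂ * d₂)) + γ t j * (Z * (evenPoch t * d₀))
        ≈⟨ +-cong (+-cong (*-congˡ (*-congʳ (^-split q (2 ℕ.* t ℕ.* j ∷ 2 ℕ.* j ∷ []) 2[1+t]j)))
                          (*-congˡ (*-congʳ (^-split q (2 ℕ.* t ℕ.* j ∷ 2 ℕ.* j ∷ 2 ℕ.* j ∷ []) 2[2+t]j))))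
                  refl ⟨
      nextRow j (twisted j) (2 ℕ.+ t) ∎
      where
      y K Z E₁ E₂ d₀ d₁ d₂ : Carrier
      y  = odd j
      K  = q ^ (2 ℕ.* j)
      Z  = q ^ (2 ℕ.* t ℕ.* j)
      E₁ = evenPoch (suc t)
      E₂ = evenPoch (2 ℕ.+ t)
      d₀ = coeff j t
      d₁ = coeff j (suc t)
      d₂ = coeff j (2 ℕ.+ t)
      2[2+t][1+j] : 2 ℕ.* (2 ℕ.+ t) ℕ.* suc j
                    ≡ 2 ℕ.* t ℕ.* j ℕ.+ (2 ℕ.* j ℕ.+ (2 ℕ.* j ℕ.+ ((2 ℕ.+ t) ℕ.+ (2 ℕ.+ t))))
      2[2+t][1+j] = ℕ-Solver.solve (t ∷ j ∷ [])
      2[1+t]j : 2 ℕ.* suc t ℕ.* j ≡ 2 ℕ.* t ℕ.* j ℕ.+ 2 ℕ.* j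
      2[1+t]j = ℕ-Solver.solve (t ∷ j ∷ [])
      2[2+t]j : 2 ℕ.* (2 ℕ.+ t) ℕ.* j ≡ 2 ℕ.* t ℕ.* j ℕ.+ (2 ℕ.* j ℕ.+ 2 ℕ.* j)
      2[2+t]j = ℕ-Solver.solve (t ∷ j ∷ [])

    -- Both sides of gaussian-nextRow at s = 2 + t divided by the common factor Φ (GaussianStep),
    -- at A = q^t, K² = q^(4j), W = q^(2(2j-t)), W′ = q^(2(2j-t-1)).
    pascal⁻ : Carrier → Carrier → Carrier → Carrier → Carrier
    pascal⁻ A K² W W′ = A * A * (1# + q * q * K²) * (1# - A * A * q ^ 4) * (1# - W)
                      + A * A * A * A * q ^ 4 * ((1# - W′) * (1# - W))
                      + K² * (1# - A * A * q ^ 4) * (1# - A * A * q ^ 2)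

    pascal⁺ : Carrier → Carrier → Carrier
    pascal⁺ A K² = A * A * (1# - K² * q ^ 4) * (1# - K² * q ^ 2)

    pascal⁻-cong : ∀ A {K² L² W U} W′ → K² ≈ L² → W ≈ U → pascal⁻ A K² W W′ ≈ pascal⁻ A L² U W′
    pascal⁻-cong A W′ k w = +-cong (+-cong (*-cong (*-congʳ (*-congˡ (+-congˡ (*-congˡ k)))) (1-cong w))
                                           (*-congˡ (*-congˡ (1-cong w))))
                                   (*-congʳ (*-congʳ k))

    pascal⁺-cong : ∀ A {K² L²} → K² ≈ L² → pascal⁺ A K² ≈ pascal⁺ A L²
    pascal⁺-cong A k = *-cong (*-congˡ (1-cong (*-congʳ k))) (1-cong (*-congʳ k))

    pascal-interior : ∀ A v → let K = A * (q * v) in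
      pascal⁻ A (K * K) (q * v * (q * v)) (v * v) ≈ pascal⁺ A (K * K)
    pascal-interior A v = solve 3 (λ A v q → let K = A :* (q :* v); q² = q :* (q :* :1); q⁴ = q :* (q :* q²) in
        A :* A :* (:1 :+ q :* q :* (K :* K)) :* (:1 :- A :* A :* q⁴) :* (:1 :- q :* v :* (q :* v))
        :+ A :* A :* A :* A :* q⁴ :* ((:1 :- v :* v) :* (:1 :- q :* v :* (q :* v)))
        :+ K :* K :* (:1 :- A :* A :* q⁴) :* (:1 :- A :* A :* q²)
        := A :* A :* (:1 :- K :* K :* q⁴) :* (:1 :- K :* K :* q²)) refl A v q

    pascal-top : ∀ A W′ → pascal⁻ A (A * A) (1# * 1#) W′ ≈ pascal⁺ A (A * A)
    pascal-top A W′ = solve 3 (λ A W′ q → let q² = q :* (q :* :1); q⁴ = q :* (q :* q²) in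
        A :* A :* (:1 :+ q :* q :* (A :* A)) :* (:1 :- A :* A :* q⁴) :* (:1 :- :1 :* :1)
        :+ A :* A :* A :* A :* q⁴ :* ((:1 :- W′) :* (:1 :- :1 :* :1))
        :+ A :* A :* (:1 :- A :* A :* q⁴) :* (:1 :- A :* A :* q²)
        := A :* A :* (:1 :- A :* A :* q⁴) :* (:1 :- A :* A :* q²)) refl A W′ q

    pascal-descending : ∀ n t → let A = q ^ t; K = q ^ n; V = q ^ (n ∸ t); V′ = q ^ (n ∸ suc t) in
      descending n t * pascal⁻ A (K * K) (V * V) (V′ * V′) ≈ descending n t * pascal⁺ A (K * K)
    pascal-descending n t with ℕ.<-cmp t n
    ... | tri< t<n _ _ = *-congˡ (begin
      pascal⁻ A (K * K) (V * V) (v * v)                       ≈⟨ pascal⁻-cong A (v * v) KK VV ⟩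
      pascal⁻ A (Aqv * Aqv) (q * v * (q * v)) (v * v)         ≈⟨ pascal-interior A v ⟩
      pascal⁺ A (Aqv * Aqv)                                   ≈⟨ pascal⁺-cong A KK ⟨
      pascal⁺ A (K * K)                                       ∎)
      where
      m : ℕ
      m = n ∸ suc t
      A K V v Aqv : Carrier
      A = q ^ t
      K = q ^ n
      V = q ^ (n ∸ t)
      v = q ^ m
      Aqv = A * (q * v)
      n≡t+1+m : n ≡ t ℕ.+ suc m
      n≡t+1+m = ≡.trans (≡.sym (ℕ.m+[n∸m]≡n t<n)) (≡.sym (ℕ.+-suc t m))
      KK : K * K ≈ Aqv * Aqv
      KK = let K≈Aqv = trans (^-congʳ q n≡t+1+m) (^-+ q t (suc m)) in *-cong K≈Aqv K≈Aqv
      VV : V * V ≈ q * v * (q * v)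
      VV = reflexive (≡.cong (λ e → q ^ e * q ^ e) (≡.trans (≡.cong (_∸ t) n≡t+1+m) (ℕ.m+n∸m≡n t (suc m))))
    ... | tri≈ _ ≡.refl _ = *-congˡ (trans (pascal⁻-cong A _ refl (*-cong V≈1 V≈1)) (pascal-top A _))
      where
      A : Carrier
      A = q ^ t
      V≈1 : q ^ (t ∸ t) ≈ 1#
      V≈1 = ^-congʳ q (ℕ.n∸n≡0 t)
    ... | tri> _ _ n<t = trans (*-congʳ f≈0) (trans (zeroˡ _) (sym (trans (*-congʳ f≈0) (zeroˡ _))))
      where
      f≈0 : descending n t ≈ 0#
      f≈0 = descending-vanishes n t n<t

    module GaussianStep (j t : ℕ) where
      A K P V V′ f Φ : Carrier
      A  = q ^ t
      K  = q ^ (2 ℕ.* j)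
      P  = q ^ (t ℕ.* t ℕ.+ j ℕ.* j)
      V  = q ^ (2 ℕ.* j ∸ t)
      V′ = q ^ (2 ℕ.* j ∸ suc t)
      f  = descending (2 ℕ.* j) t
      Φ  = P * (A * A * q ^ 5 * K)

      gaussian-top : gaussian (suc j) (2 ℕ.+ t) ≈ Φ * (f * pascal⁺ A (K * K))
      gaussian-top = begin
        q ^ ((2 ℕ.+ t) ℕ.* (2 ℕ.+ t) ℕ.+ suc j ℕ.* suc j) * descending (2 ℕ.* suc j) (2 ℕ.+ t)
          ≈⟨ *-cong (^-split q (t ℕ.* t ℕ.+ j ℕ.* j ∷ t ∷ t ∷ t ∷ t ∷ 5 ∷ 2 ℕ.* j ∷ []) exponent)
                    top-factors ⟩
        P * (A * (A * (A * (A * (q ^ 5 * K))))) * ((1# - q * (q * K) * (q * (q * K))) * ((1# - q * K * (q * K)) * f))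
          ≈⟨ solve 5 (λ P A q K f → let q² = q :* (q :* :1); q⁴ = q :* (q :* q²); q⁵ = q :* q⁴ in
               P :* (A :* (A :* (A :* (A :* (q⁵ :* K)))))
                 :* ((:1 :- q :* (q :* K) :* (q :* (q :* K))) :* ((:1 :- q :* K :* (q :* K)) :* f))
               := P :* (A :* A :* q⁵ :* K) :* (f :* (A :* A :* (:1 :- K :* K :* q⁴) :* (:1 :- K :* K :* q²))))
             refl P A q K f ⟩
        Φ * (f * pascal⁺ A (K * K)) ∎
        where
        exponent : (2 ℕ.+ t) ℕ.* (2 ℕ.+ t) ℕ.+ suc j ℕ.* suc j
                   ≡ t ℕ.* t ℕ.+ j ℕ.* j ℕ.+ (t ℕ.+ (t ℕ.+ (t ℕ.+ (t ℕ.+ (5 ℕ.+ 2 ℕ.* j)))))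
        exponent = ℕ-Solver.solve (t ∷ j ∷ [])
        2[1+j] : 2 ℕ.* suc j ≡ 2 ℕ.+ 2 ℕ.* j
        2[1+j] = ℕ-Solver.solve (j ∷ [])
        top-factors : descending (2 ℕ.* suc j) (2 ℕ.+ t) ≈ (1# - q * (q * K) * (q * (q * K))) * ((1# - q * K * (q * K)) * f)
        top-factors = trans (reflexive (≡.cong (λ m → descending m (2 ℕ.+ t)) 2[1+j]))
                            (trans (descending-suc (suc (2 ℕ.* j)) (suc t)) (*-congˡ (descending-suc (2 ℕ.* j) t)))

      nextRow-gaussian : nextRow j (gaussian j) (2 ℕ.+ t) ≈ Φ * (f * pascal⁻ A (K * K) (V * V) (V′ * V′))
      nextRow-gaussian = begin
        nextRow j (gaussian j) (2 ℕ.+ t)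
          ≈⟨ +-cong (+-cong (*-congˡ (*-congʳ (^-split q (t ℕ.* t ℕ.+ j ℕ.* j ∷ t ∷ t ∷ 1 ∷ []) [1+t]²+j²)))
                            (*-congˡ (*-congʳ (^-split q (t ℕ.* t ℕ.+ j ℕ.* j ∷ t ∷ t ∷ t ∷ t ∷ 4 ∷ []) [2+t]²+j²))))
                    refl ⟩
        α (2 ℕ.+ t) j * (P * (A * (A * q ^ 1)) * ((1# - V * V) * f))
          + β (2 ℕ.+ t) j * (P * (A * (A * (A * (A * q ^ 4)))) * ((1# - V′ * V′) * ((1# - V * V) * f)))
          + γ t j * (P * f)
          ≈⟨ solve 7 (λ P A q K f V V′ → let y = q :* K; B₁ = q :* A; B₂ = q :* (q :* A); W = V :* V; W′ = V′ :* V′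
                                             q² = q :* (q :* :1); q⁴ = q :* (q :* q²); q⁵ = q :* q⁴ in
               B₂ :* B₂ :* K :* (:1 :+ y :* y) :* (:1 :- B₂ :* B₂) :* (P :* (A :* (A :* (q :* :1))) :* ((:1 :- W) :* f))
                 :+ B₂ :* B₂ :* y :* (P :* (A :* (A :* (A :* (A :* q⁴)))) :* ((:1 :- W′) :* ((:1 :- W) :* f)))
                 :+ B₂ :* B₂ :* K :* K :* y :* (:1 :- B₂ :* B₂) :* (:1 :- B₁ :* B₁) :* (P :* f)
               := P :* (A :* A :* q⁵ :* K) :* (f :* (A :* A :* (:1 :+ q :* q :* (K :* K)) :* (:1 :- A :* A :* q⁴) :* (:1 :- W)
                                                  :+ A :* A :* A :* A :* q⁴ :* ((:1 :- W′) :* (:1 :- W))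
                                                  :+ K :* K :* (:1 :- A :* A :* q⁴) :* (:1 :- A :* A :* q²))))
             refl P A q K f V V′ ⟩
        Φ * (f * pascal⁻ A (K * K) (V * V) (V′ * V′)) ∎
        where
        [1+t]²+j² : suc t ℕ.* suc t ℕ.+ j ℕ.* j ≡ t ℕ.* t ℕ.+ j ℕ.* j ℕ.+ (t ℕ.+ (t ℕ.+ 1))
        [1+t]²+j² = ℕ-Solver.solve (t ∷ j ∷ [])
        [2+t]²+j² : (2 ℕ.+ t) ℕ.* (2 ℕ.+ t) ℕ.+ j ℕ.* j
                    ≡ t ℕ.* t ℕ.+ j ℕ.* j ℕ.+ (t ℕ.+ (t ℕ.+ (t ℕ.+ (t ℕ.+ 4))))
        [2+t]²+j² = ℕ-Solver.solve (t ∷ j ∷ [])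

    gaussian-nextRow : ∀ j s → gaussian (suc j) s ≈ nextRow j (gaussian j) s
    gaussian-nextRow j zero = begin
      q ^ (suc j ℕ.* suc j) * 1#         ≈⟨ *-congʳ (^-split q (1 ∷ 2 ℕ.* j ∷ j ℕ.* j ∷ []) [1+j]²) ⟩
      q ^ 1 * (K * P) * 1#               ≈⟨ solve 3 (λ q K P → q :* :1 :* (K :* P) :* :1
                                                           := :1 :* :1 :* (q :* K) :* (P :* :1)) refl q K P ⟩
      nextRow j (gaussian j) 0           ∎
      where
      K P : Carrier
      K = q ^ (2 ℕ.* j)
      P = q ^ (j ℕ.* j)
      [1+j]² : suc j ℕ.* suc j ≡ 1 ℕ.+ (2 ℕ.* j ℕ.+ j ℕ.* j)
      [1+j]² = ℕ-Solver.solve (j ∷ [])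
    gaussian-nextRow j (suc zero) = begin
      q ^ (1 ℕ.+ suc j ℕ.* suc j) * ((1# - q ^ (2 ℕ.* suc j) * q ^ (2 ℕ.* suc j)) * 1#)
        ≈⟨ *-cong (^-split q (2 ∷ 2 ℕ.* j ∷ j ℕ.* j ∷ []) 1+[1+j]²) (*-congʳ (1-cong (*-cong q²K q²K))) ⟩
      q ^ 2 * (K * P) * ((1# - q ^ 2 * K * (q ^ 2 * K)) * 1#)
        ≈⟨ solve 3 (λ q K P → let q¹ = q :* :1; q² = q :* q¹; y = q :* K in
             q² :* (K :* P) :* ((:1 :- q² :* K :* (q² :* K)) :* :1)
             := q¹ :* q¹ :* K :* (:1 :+ y :* y) :* (:1 :- q¹ :* q¹) :* (P :* :1)
                :+ q¹ :* q¹ :* y :* (q :* P :* ((:1 :- K :* K) :* :1)))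
           refl q K P ⟩
      nextRow j (gaussian j) 1 ∎
      where
      K P : Carrier
      K = q ^ (2 ℕ.* j)
      P = q ^ (j ℕ.* j)
      1+[1+j]² : 1 ℕ.+ suc j ℕ.* suc j ≡ 2 ℕ.+ (2 ℕ.* j ℕ.+ j ℕ.* j)
      1+[1+j]² = ℕ-Solver.solve (j ∷ [])
      2[1+j] : 2 ℕ.* suc j ≡ 2 ℕ.+ 2 ℕ.* j
      2[1+j] = ℕ-Solver.solve (j ∷ [])
      q²K : q ^ (2 ℕ.* suc j) ≈ q ^ 2 * K
      q²K = ^-split q (2 ∷ 2 ℕ.* j ∷ []) 2[1+j]
    gaussian-nextRow j (suc (suc t)) = begin
      gaussian (suc j) (2 ℕ.+ t)                        ≈⟨ gaussian-top ⟩
      Φ * (f * pascal⁺ A (K * K))                       ≈⟨ *-congˡ (pascal-descending (2 ℕ.* j) t) ⟨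
      Φ * (f * pascal⁻ A (K * K) (V * V) (V′ * V′))     ≈⟨ nextRow-gaussian ⟨
      nextRow j (gaussian j) (2 ℕ.+ t)                  ∎
      where open GaussianStep j t

    coeff-closed-form : ∀ j s → twisted j s ≈ gaussian j s
    coeff-closed-form zero    zero    = *-congˡ (*-identityˡ 1#)
    coeff-closed-form zero    (suc t) = trans (*-congˡ (zeroʳ _)) (trans (zeroʳ _)
      (sym (trans (*-congˡ (descending-vanishes 0 (suc t) (s≤s z≤n))) (zeroʳ _))))
    coeff-closed-form (suc j) s = begin
      twisted (suc j) s          ≈⟨ twisted-nextRow j s ⟩
      nextRow j (twisted j) s    ≈⟨ nextRow-cong j (coeff-closed-form j) s ⟩
      nextRow j (gaussian j) s   ≈⟨ gaussian-nextRow j s ⟨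
      gaussian (suc j) s         ∎

    product-at-1 : ∀ j → product 1# j ≈ oddPoch⁺ j * oddPoch⁺ j
    product-at-1 zero    = sym (*-identityˡ 1#)
    product-at-1 (suc j) = trans (*-congˡ (product-at-1 j))
      (solve 2 (λ y P → (:1 :+ y) :* (:1 :+ :1 :* y) :* (P :* P) := (:1 :+ y) :* P :* ((:1 :+ y) :* P)) refl (odd j) (oddPoch⁺ j))

    product-at-−1 : ∀ j → product (- 1#) j ≈ (- 1#) ^ j * (oddPoch⁻ j * oddPoch⁻ j)
    product-at-−1 zero    = sym (trans (*-identityˡ _) (*-identityˡ 1#))
    product-at-−1 (suc j) = trans (*-congˡ (product-at-−1 j))
      (solve 3 (λ y s P → (:- :1 :+ y) :* (:1 :+ :- :1 :* y) :* (s :* (P :* P))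
                          := :- :1 :* s :* ((:1 :- y) :* P :* ((:1 :- y) :* P)))
         refl (odd j) ((- 1#) ^ j) (oddPoch⁻ j))

    oddPoch-ratio : (u : ℕ → Carrier) → u 0 ≈ 1# → (∀ j → u (suc j) ≈ u j + odd j * (u j + u (suc j))) →
                    ∀ j → u j * oddPoch⁻ j ≈ oddPoch⁺ j
    oddPoch-ratio u u₀ u-rec zero    = trans (*-identityʳ _) u₀
    oddPoch-ratio u u₀ u-rec (suc j) = begin
      u (suc j) * ((1# - odd j) * oddPoch⁻ j)   ≈⟨ x∙yz≈y∙xz _ _ _ ⟩
      (1# - odd j) * (u (suc j) * oddPoch⁻ j)   ≈⟨ *-assoc _ _ _ ⟨
      (1# - odd j) * u (suc j) * oddPoch⁻ j     ≈⟨ *-congʳ clear-denominator ⟩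
      (1# + odd j) * u j * oddPoch⁻ j           ≈⟨ *-assoc _ _ _ ⟩
      (1# + odd j) * (u j * oddPoch⁻ j)         ≈⟨ *-congˡ (oddPoch-ratio u u₀ u-rec j) ⟩
      oddPoch⁺ (suc j)                          ∎
      where
      clear-denominator : (1# - odd j) * u (suc j) ≈ (1# + odd j) * u j
      clear-denominator = begin
        (1# - odd j) * u (suc j)
          ≈⟨ solve 2 (λ y a → (:1 :- y) :* a := a :- y :* a) refl (odd j) (u (suc j)) ⟩
        u (suc j) - odd j * u (suc j)
          ≈⟨ +-congʳ (u-rec j) ⟩
        u j + odd j * (u j + u (suc j)) - odd j * u (suc j)
          ≈⟨ solve 3 (λ y a b → a :+ y :* (a :+ b) :- y :* b := (:1 :+ y) :* a) refl (odd j) (u j) (u (suc j)) ⟩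
        (1# + odd j) * u j ∎

  module JacobiTripleSquaring (q : Carrier) where
    module J₁ = JacobiTriple q
    module J₂ = JacobiTriple (q * q)

    oddPoch⁻-square : ∀ j → J₂.oddPoch⁻ j ≈ J₁.oddPoch⁻ j * J₁.oddPoch⁺ j
    oddPoch⁻-square zero    = sym (*-identityˡ 1#)
    oddPoch⁻-square (suc j) = trans (*-cong (1-cong (^-distrib-* q q (suc (2 ℕ.* j)))) (oddPoch⁻-square j))
      (solve 3 (λ y a b → (:1 :- y :* y) :* (a :* b) := (:1 :- y) :* a :* ((:1 :+ y) :* b))
             refl (J₁.odd j) (J₁.oddPoch⁻ j) (J₁.oddPoch⁺ j))

    evenPoch-square : ∀ j → J₁.evenPoch (2 ℕ.* j) ≈ J₂.evenPoch j * J₂.oddPoch⁻ j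
    evenPoch-square zero    = sym (*-identityˡ 1#)
    evenPoch-square (suc j) = begin
      J₁.evenPoch (2 ℕ.* suc j)                      ≡⟨ ≡.cong J₁.evenPoch 2[1+j] ⟩
      (1# - a * a) * ((1# - b * b) * J₁.evenPoch (2 ℕ.* j))
        ≈⟨ *-congˡ (*-congˡ (evenPoch-square j)) ⟩
      (1# - a * a) * ((1# - b * b) * (J₂.evenPoch j * J₂.oddPoch⁻ j))
        ≈⟨ solve 4 (λ a b E O → (:1 :- a :* a) :* ((:1 :- b :* b) :* (E :* O)) := (:1 :- a :* a) :* E :* ((:1 :- b :* b) :* O))
             refl a b (J₂.evenPoch j) (J₂.oddPoch⁻ j) ⟩
      (1# - a * a) * J₂.evenPoch j * ((1# - b * b) * J₂.oddPoch⁻ j)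
        ≈⟨ *-cong (*-congʳ (1-cong (*-cong a≈ a≈))) (*-congʳ (1-cong (^-distrib-* q q (suc (2 ℕ.* j))))) ⟨
      J₂.evenPoch (suc j) * J₂.oddPoch⁻ (suc j)      ∎
      where
      a b : Carrier
      a = q ^ suc (suc (2 ℕ.* j))
      b = q ^ suc (2 ℕ.* j)
      2[1+j] : 2 ℕ.* suc j ≡ suc (suc (2 ℕ.* j))
      2[1+j] = ℕ-Solver.solve (j ∷ [])
      a≈ : (q * q) ^ suc j ≈ a
      a≈ = trans (^-square q (suc j)) (^-congʳ q 2[1+j])

  theta-fold : ∀ z → z * z ≈ 1# → ∀ w j →
    ∑ (suc (2 ℕ.* j)) (λ t → z ^ t * w ∣ t - j ∣) ≈ z ^ j * (w 0 + 2# * thetaPartial z w j)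
  theta-fold z zz w zero = solve 2 (λ z w₀ → :1 :* w₀ :+ con (+ 0) := :1 :* (w₀ :+ (:1 :+ :1) :* con (+ 0))) refl z (w 0)
  theta-fold z zz w (suc j) = begin
    ∑ (suc (2 ℕ.* suc j)) f                                   ≡⟨ ≡.cong (λ n → ∑ (suc n) f) 2[1+j] ⟩
    f 0 + ∑ (suc (suc (2 ℕ.* j))) (λ t → f (suc t))           ≈⟨ +-congˡ (∑-snoc (suc (2 ℕ.* j)) (λ t → f (suc t))) ⟩
    f 0 + (∑ (suc (2 ℕ.* j)) (λ t → f (suc t)) + f (suc (suc (2 ℕ.* j))))
      ≈⟨ +-congˡ (+-cong shifted-terms last-term) ⟩
    1# * w′ + (z * (z ^ j * (w 0 + 2# * T)) + u * u * w′)     ≈⟨ +-congʳ (*-congʳ (sym (^-square-one zz (suc j)))) ⟩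
    u * u * w′ + (z * (z ^ j * (w 0 + 2# * T)) + u * u * w′)
      ≈⟨ solve 5 (λ z s w₀ T w′ → let u = z :* s in
           u :* u :* w′ :+ (z :* (s :* (w₀ :+ (:1 :+ :1) :* T)) :+ u :* u :* w′)
           := u :* (w₀ :+ (:1 :+ :1) :* (T :+ u :* w′))) refl z (z ^ j) (w 0) T w′ ⟩
    z ^ suc j * (w 0 + 2# * thetaPartial z w (suc j))         ∎
    where
    f : ℕ → Carrier
    f t = z ^ t * w ∣ t - suc j ∣
    u w′ T : Carrier
    u  = z ^ suc j
    w′ = w (suc j)
    T  = thetaPartial z w j
    2[1+j] : 2 ℕ.* suc j ≡ suc (suc (2 ℕ.* j))
    2[1+j] = ℕ-Solver.solve (j ∷ [])
    2+2j : suc (suc (2 ℕ.* j)) ≡ suc j ℕ.+ suc j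
    2+2j = ℕ-Solver.solve (j ∷ [])
    shifted-terms : ∑ (suc (2 ℕ.* j)) (λ t → f (suc t)) ≈ z * (z ^ j * (w 0 + 2# * T))
    shifted-terms = trans (∑-cong (suc (2 ℕ.* j)) (λ t _ → *-assoc z (z ^ t) (w ∣ t - j ∣)))
                          (trans (∑-*ˡ (suc (2 ℕ.* j)) z (λ t → z ^ t * w ∣ t - j ∣)) (*-congˡ (theta-fold z zz w j)))
    last-term : f (suc (suc (2 ℕ.* j))) ≈ u * u * w′
    last-term = *-cong (trans (^-congʳ z 2+2j) (^-+ z (suc j) (suc j)))
                       (reflexive (≡.cong w distance))
      where
      distance : ∣ suc (suc (2 ℕ.* j)) - suc j ∣ ≡ suc j
      distance = ≡.trans (≡.cong (∣_- suc j ∣) 2+2j)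
                         (≡.trans (ℕ.∣-∣-comm (suc j ℕ.+ suc j) (suc j)) (ℕ.∣m-m+n∣≡n (suc j) (suc j)))

  thetaPartial-stable : ∀ z w N → (∀ k → N < k → w k ≈ 0#) → ∀ d → thetaPartial z w (N ℕ.+ d) ≈ thetaPartial z w N
  thetaPartial-stable z w N w≈0 zero    = reflexive (≡.cong (thetaPartial z w) (ℕ.+-identityʳ N))
  thetaPartial-stable z w N w≈0 (suc d) = begin
    thetaPartial z w (N ℕ.+ suc d)                                ≡⟨ ≡.cong (thetaPartial z w) (ℕ.+-suc N d) ⟩
    thetaPartial z w (N ℕ.+ d) + z ^ suc (N ℕ.+ d) * w (suc (N ℕ.+ d))
      ≈⟨ +-congˡ (trans (*-congˡ (w≈0 _ (s≤s (ℕ.m≤m+n N d)))) (zeroʳ _)) ⟩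
    thetaPartial z w (N ℕ.+ d) + 0#                                ≈⟨ +-identityʳ _ ⟩
    thetaPartial z w (N ℕ.+ d)                                     ≈⟨ thetaPartial-stable z w N w≈0 d ⟩
    thetaPartial z w N                                             ∎

module PowerSeries where
  open import Data.Integer using (+_)
  Series : Set
  Series = ℕ → ℤ

  infixl 6 _⊕_
  infixl 7 _⊛_

  _⊕_ : Series → Series → Series
  (f ⊕ g) n = f n ℤ.+ g n

  ⊖_ : Series → Series
  (⊖ f) n = ℤ.- f n

  𝟘 𝟙 : Series
  𝟘 _       = + 0
  𝟙 zero    = + 1
  𝟙 (suc _) = + 0

  _⊛_ : Series → Series → Series
  (f ⊛ g) zero    = f 0 ℤ.* g 0
  (f ⊛ g) (suc n) = f 0 ℤ.* g (suc n) ℤ.+ ((λ i → f (suc i)) ⊛ g) n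

  ⊛-cong-≤ : ∀ n {f f′ g g′} → (∀ i → i ≤ n → f i ≡ f′ i) → (∀ i → i ≤ n → g i ≡ g′ i) →
             (f ⊛ g) n ≡ (f′ ⊛ g′) n
  ⊛-cong-≤ zero    f≡ g≡ = cong₂ ℤ._*_ (f≡ 0 z≤n) (g≡ 0 z≤n)
  ⊛-cong-≤ (suc n) f≡ g≡ = cong₂ ℤ._+_ (cong₂ ℤ._*_ (f≡ 0 z≤n) (g≡ (suc n) ℕ.≤-refl))
    (⊛-cong-≤ n (λ i i≤n → f≡ (suc i) (s≤s i≤n)) (λ i i≤n → g≡ i (ℕ.m≤n⇒m≤1+n i≤n)))

  𝟘-⊛ : ∀ g → 𝟘 ⊛ g ≗ 𝟘
  𝟘-⊛ g zero    = ≡.refl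
  𝟘-⊛ g (suc n) = ≡.trans (ℤ.+-identityˡ _) (𝟘-⊛ g n)

  𝟙-⊛ : ∀ g → 𝟙 ⊛ g ≗ g
  𝟙-⊛ g zero    = ℤ.*-identityˡ (g 0)
  𝟙-⊛ g (suc n) = ≡.trans (cong₂ ℤ._+_ (ℤ.*-identityˡ (g (suc n))) (𝟘-⊛ g n)) (ℤ.+-identityʳ _)

  ⊛-suc : ∀ f g n → (f ⊛ g) (suc n) ≡ (f ⊛ (λ i → g (suc i))) n ℤ.+ f (suc n) ℤ.* g 0
  ⊛-suc f g zero    = ≡.refl
  ⊛-suc f g (suc n) = ≡.trans (cong (λ x → f 0 ℤ.* g (2 ℕ.+ n) ℤ.+ x) (⊛-suc (λ i → f (suc i)) g n))
    (≡.sym (ℤ.+-assoc (f 0 ℤ.* g (2 ℕ.+ n)) _ (f (2 ℕ.+ n) ℤ.* g 0)))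

  ⊛-comm : ∀ f g → f ⊛ g ≗ g ⊛ f
  ⊛-comm f g zero    = ℤ.*-comm (f 0) (g 0)
  ⊛-comm f g (suc n) = begin
    f 0 ℤ.* g (suc n) ℤ.+ (f′ ⊛ g) n   ≡⟨ cong₂ ℤ._+_ (ℤ.*-comm (f 0) (g (suc n))) (⊛-comm f′ g n) ⟩
    g (suc n) ℤ.* f 0 ℤ.+ (g ⊛ f′) n   ≡⟨ ℤ.+-comm (g (suc n) ℤ.* f 0) ((g ⊛ f′) n) ⟩
    (g ⊛ f′) n ℤ.+ g (suc n) ℤ.* f 0   ≡⟨ ⊛-suc g f n ⟨
    (g ⊛ f) (suc n)                    ∎
    where
    open ≡.≡-Reasoning
    f′ : Series
    f′ i = f (suc i)

  ⊛-distribʳ-⊕ : ∀ f f′ g → (f ⊕ f′) ⊛ g ≗ f ⊛ g ⊕ f′ ⊛ g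
  ⊛-distribʳ-⊕ f f′ g zero    = ℤ.*-distribʳ-+ (g 0) (f 0) (f′ 0)
  ⊛-distribʳ-⊕ f f′ g (suc n) =
    ≡.trans (cong₂ ℤ._+_ (ℤ.*-distribʳ-+ (g (suc n)) (f 0) (f′ 0)) (⊛-distribʳ-⊕ _ _ g n))
            (interchange (f 0 ℤ.* g (suc n)) (f′ 0 ℤ.* g (suc n)) _ _)
    where
    interchange : ∀ a b c d → (a ℤ.+ b) ℤ.+ (c ℤ.+ d) ≡ (a ℤ.+ c) ℤ.+ (b ℤ.+ d)
    interchange = ℤ-Solver.solve-∀

  ⊛-scaleˡ : ∀ c f g → (λ i → c ℤ.* f i) ⊛ g ≗ (λ n → c ℤ.* (f ⊛ g) n)
  ⊛-scaleˡ c f g zero    = ℤ.*-assoc c (f 0) (g 0)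
  ⊛-scaleˡ c f g (suc n) = ≡.trans (cong₂ ℤ._+_ (ℤ.*-assoc c (f 0) (g (suc n))) (⊛-scaleˡ c _ g n))
    (≡.sym (ℤ.*-distribˡ-+ c _ _))

  ⊖-⊛ : ∀ f g → (⊖ f) ⊛ g ≗ ⊖ (f ⊛ g)
  ⊖-⊛ f g zero    = ≡.sym (ℤ.neg-distribˡ-* (f 0) (g 0))
  ⊖-⊛ f g (suc n) = ≡.trans (cong₂ ℤ._+_ (≡.sym (ℤ.neg-distribˡ-* (f 0) (g (suc n)))) (⊖-⊛ _ g n))
    (≡.sym (ℤ.neg-distrib-+ (f 0 ℤ.* g (suc n)) _))

  ⊛-assoc : ∀ f g h → (f ⊛ g) ⊛ h ≗ f ⊛ (g ⊛ h)
  ⊛-assoc f g h zero    = ℤ.*-assoc (f 0) (g 0) (h 0)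
  ⊛-assoc f g h (suc n) = begin
    f 0 ℤ.* g 0 ℤ.* h (suc n) ℤ.+ (((λ m → f 0 ℤ.* g (suc m)) ⊕ f′ ⊛ g) ⊛ h) n
      ≡⟨ cong (λ x → f 0 ℤ.* g 0 ℤ.* h (suc n) ℤ.+ x) (⊛-distribʳ-⊕ (λ m → f 0 ℤ.* g (suc m)) (f′ ⊛ g) h n) ⟩
    f 0 ℤ.* g 0 ℤ.* h (suc n) ℤ.+ (((λ m → f 0 ℤ.* g (suc m)) ⊛ h) n ℤ.+ ((f′ ⊛ g) ⊛ h) n)
      ≡⟨ cong₂ (λ a b → f 0 ℤ.* g 0 ℤ.* h (suc n) ℤ.+ (a ℤ.+ b))
               (⊛-scaleˡ (f 0) (λ m → g (suc m)) h n) (⊛-assoc f′ g h n) ⟩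
    f 0 ℤ.* g 0 ℤ.* h (suc n) ℤ.+ (f 0 ℤ.* ((λ m → g (suc m)) ⊛ h) n ℤ.+ (f′ ⊛ (g ⊛ h)) n)
      ≡⟨ factor (f 0) (g 0) (h (suc n)) _ _ ⟩
    f 0 ℤ.* (g 0 ℤ.* h (suc n) ℤ.+ ((λ m → g (suc m)) ⊛ h) n) ℤ.+ (f′ ⊛ (g ⊛ h)) n ∎
    where
    open ≡.≡-Reasoning
    f′ : Series
    f′ i = f (suc i)
    factor : ∀ a b c d e → a ℤ.* b ℤ.* c ℤ.+ (a ℤ.* d ℤ.+ e) ≡ a ℤ.* (b ℤ.* c ℤ.+ d) ℤ.+ e
    factor = ℤ-Solver.solve-∀

  infix 4 _≈[_]_
  _≈[_]_ : Series → ℕ → Series → Set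
  f ≈[ N ] g = ∀ n → n < N → f n ≡ g n

  module Truncated (N : ℕ) where
    _≈_ : Series → Series → Set
    f ≈ g = f ≈[ N ] g

    ≗⇒≈ : ∀ {f g} → f ≗ g → f ≈ g
    ≗⇒≈ f≗g n _ = f≗g n

    isCommutativeRing : IsCommutativeRing _≈_ _⊕_ _⊛_ ⊖_ 𝟘 𝟙
    isCommutativeRing = record
      { isRing = record
        { +-isAbelianGroup = record
          { isGroup = record
            { isMonoid = record
              { isSemigroup = record
                { isMagma = record
                  { isEquivalence = record
                    { refl  = λ _ _ → ≡.refl
                    ; sym   = λ f≈g n n<N → ≡.sym (f≈g n n<N)
                    ; trans = λ f≈g g≈h n n<N → ≡.trans (f≈g n n<N) (g≈h n n<N) }
                  ; ∙-cong = λ f≈f′ g≈g′ n n<N → cong₂ ℤ._+_ (f≈f′ n n<N) (g≈g′ n n<N) }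
                ; assoc = λ f g h → ≗⇒≈ (λ n → ℤ.+-assoc (f n) (g n) (h n)) }
              ; identity = (λ f → ≗⇒≈ (λ n → ℤ.+-identityˡ (f n))) , (λ f → ≗⇒≈ (λ n → ℤ.+-identityʳ (f n))) }
            ; inverse = (λ f → ≗⇒≈ (λ n → ℤ.+-inverseˡ (f n))) , (λ f → ≗⇒≈ (λ n → ℤ.+-inverseʳ (f n)))
            ; ⁻¹-cong = λ f≈g n n<N → cong ℤ.-_ (f≈g n n<N) }
          ; comm = λ f g → ≗⇒≈ (λ n → ℤ.+-comm (f n) (g n)) }
        ; *-cong = λ f≈f′ g≈g′ n n<N → ⊛-cong-≤ n (λ i i≤n → f≈f′ i (ℕ.≤-<-trans i≤n n<N))
                                                  (λ i i≤n → g≈g′ i (ℕ.≤-<-trans i≤n n<N))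
        ; *-assoc = λ f g h → ≗⇒≈ (⊛-assoc f g h)
        ; *-identity = (λ f → ≗⇒≈ (𝟙-⊛ f)) , (λ f → ≗⇒≈ (λ n → ≡.trans (⊛-comm f 𝟙 n) (𝟙-⊛ f n)))
        ; distrib = (λ f g h → ≗⇒≈ (λ n → ≡.trans (⊛-comm f (g ⊕ h) n)
                                          (≡.trans (⊛-distribʳ-⊕ g h f n) (cong₂ ℤ._+_ (⊛-comm g f n) (⊛-comm h f n)))))
                  , (λ f g h → ≗⇒≈ (⊛-distribʳ-⊕ g h f)) }
      ; *-comm = λ f g → ≗⇒≈ (⊛-comm f g) }

    truncatedRing : CommutativeRing 0ℓ 0ℓ
    truncatedRing = record { isCommutativeRing = isCommutativeRing }

module Overpartitions where
  open import Defs
  open import Data.Bool using (true; false)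
  open import Data.Bool.Properties using (T-≡)
  open import Data.Nat
  open import Data.Unit using (tt)
  open import Function.Bundles using (Equivalence)
  open import Relation.Nullary using (¬_)
  open ≡ using (refl)
  open ≡.≡-Reasoning

  ≤ᵇ-true : ∀ {m n} → m ≤ n → (m ≤ᵇ n) ≡ true
  ≤ᵇ-true m≤n = Equivalence.to T-≡ (ℕ.≤⇒≤ᵇ m≤n)

  ≤ᵇ-false : ∀ {m n} → ¬ m ≤ n → (m ≤ᵇ n) ≡ false
  ≤ᵇ-false {m} {n} m≰n with m ≤ᵇ n | ℕ.≤ᵇ⇒≤ m n
  ... | false | _    = refl
  ... | true  | m≤n = ⊥-elim (m≰n (m≤n tt))

  ≤ᵇ-suc : ∀ m n → (suc m ≤ᵇ suc n) ≡ (m ≤ᵇ n)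
  ≤ᵇ-suc zero    n = refl
  ≤ᵇ-suc (suc m) n = refl

  ≤ᵇ-+ : ∀ p m n → (p + m ≤ᵇ p + n) ≡ (m ≤ᵇ n)
  ≤ᵇ-+ zero    m n = refl
  ≤ᵇ-+ (suc p) m n = ≡.trans (≤ᵇ-suc (p + m) (p + n)) (≤ᵇ-+ p m n)

  sumFrom1-front : ∀ c f → sumFrom1 (suc c) f ≡ f 1 + sumFrom1 c (λ m → f (suc m))
  sumFrom1-front zero    f = ℕ.+-comm 0 (f 1)
  sumFrom1-front (suc c) f = ≡.trans (cong (_+ f (2 + c)) (sumFrom1-front c f)) (ℕ.+-assoc (f 1) _ _)

  sumFrom1-cong : ∀ c {f g} → (∀ m → f m ≡ g m) → sumFrom1 c f ≡ sumFrom1 c g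
  sumFrom1-cong zero    f≗g = refl
  sumFrom1-cong (suc c) f≗g = cong₂ _+_ (sumFrom1-cong c f≗g) (f≗g (suc c))

  sumFrom1-zero : ∀ c f → (∀ m → f (suc m) ≡ 0) → sumFrom1 c f ≡ 0
  sumFrom1-zero zero    f f≡0 = refl
  sumFrom1-zero (suc c) f f≡0 = cong₂ _+_ (sumFrom1-zero c f f≡0) (f≡0 c)

  sumFrom1-extend : ∀ c e f → (∀ m → c < m → f m ≡ 0) → sumFrom1 (c + e) f ≡ sumFrom1 c f
  sumFrom1-extend c zero    f f≡0 = cong (λ x → sumFrom1 x f) (ℕ.+-identityʳ c)
  sumFrom1-extend c (suc e) f f≡0 = ≡.trans (cong (λ x → sumFrom1 x f) (ℕ.+-suc c e))
    (≡.trans (cong₂ _+_ (sumFrom1-extend c e f f≡0) (f≡0 (suc (c + e)) (s≤s (ℕ.m≤m+n c e)))) (ℕ.+-identityʳ _))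

  module LargestPart (j : ℕ) where
    p : ℕ
    p = 2 * j + 1

    copies : ℕ → ℕ → ℕ
    copies n m = if m * p ≤ᵇ n then opBounded (n ∸ m * p) j else 0

    withP : ℕ → ℕ
    withP n = sumFrom1 n (copies n)

    instance
      p-nonZero : NonZero p
      p-nonZero = ≡.subst NonZero (ℕ.+-comm 1 (2 * j)) _

    copies-large : ∀ n m → n < m → copies n m ≡ 0
    copies-large n m n<m =
      cong (if_then opBounded (n ∸ m * p) j else 0)
           (≤ᵇ-false (λ mp≤n → ℕ.<⇒≱ n<m (ℕ.≤-trans (ℕ.m≤m*n m p) mp≤n)))

    withP-small : ∀ n → n < p → withP n ≡ 0
    withP-small n n<p = sumFrom1-zero n (copies n)
      (λ m → cong (if_then opBounded (n ∸ suc m * p) j else 0)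
                  (≤ᵇ-false (λ mp≤n → ℕ.<⇒≱ n<p (ℕ.≤-trans (ℕ.m≤m+n p (m * p)) mp≤n))))

    withP-large : ∀ r → withP (p + r) ≡ opBounded r j + withP r
    withP-large r = begin
      sumFrom1 (p + r) (copies (p + r))
        ≡⟨ cong (λ c → sumFrom1 c (copies (p + r))) p+r≡1+2j+r ⟩
      sumFrom1 (suc (2 * j + r)) (copies (p + r))
        ≡⟨ sumFrom1-front (2 * j + r) (copies (p + r)) ⟩
      copies (p + r) 1 + sumFrom1 (2 * j + r) (λ m → copies (p + r) (suc m))
        ≡⟨ cong₂ _+_ one-part (sumFrom1-cong (2 * j + r) more-parts) ⟩
      opBounded r j + sumFrom1 (2 * j + r) (copies r)
        ≡⟨ cong (opBounded r j +_) drop-large ⟩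
      opBounded r j + withP r ∎
      where
      p+r≡1+2j+r : p + r ≡ suc (2 * j + r)
      p+r≡1+2j+r = cong (_+ r) (ℕ.+-comm (2 * j) 1)
      one-part : copies (p + r) 1 ≡ opBounded r j
      one-part rewrite ℕ.*-identityˡ p | ≤ᵇ-true (ℕ.m≤m+n p r) | ℕ.m+n∸m≡n p r = refl
      more-parts : ∀ m → copies (p + r) (suc m) ≡ copies r m
      more-parts m rewrite ≤ᵇ-+ p (m * p) r | ℕ.[m+n]∸[m+o]≡n∸o p r (m * p) = refl
      drop-large : sumFrom1 (2 * j + r) (copies r) ≡ withP r
      drop-large = ≡.trans (cong (λ c → sumFrom1 c (copies r)) (ℕ.+-comm (2 * j) r))
                           (sumFrom1-extend r (2 * j) (copies r) (copies-large r))

    opBounded-suc : ∀ n → opBounded n (suc j) ≡ opBounded n j + 2 * withP n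
    opBounded-suc zero    = refl
    opBounded-suc (suc n) = refl

    opBounded-below : ∀ n → n < p → opBounded n (suc j) ≡ opBounded n j
    opBounded-below n n<p = begin
      opBounded n (suc j)           ≡⟨ opBounded-suc n ⟩
      opBounded n j + 2 * withP n   ≡⟨ cong (λ x → opBounded n j + 2 * x) (withP-small n n<p) ⟩
      opBounded n j + 0             ≡⟨ ℕ.+-identityʳ _ ⟩
      opBounded n j                 ∎

    opBounded-above : ∀ r → opBounded (p + r) (suc j) ≡ opBounded (p + r) j + (opBounded r j + opBounded r (suc j))
    opBounded-above r = begin
      opBounded (p + r) (suc j)                                  ≡⟨ opBounded-suc (p + r) ⟩
      opBounded (p + r) j + 2 * withP (p + r)                    ≡⟨ cong (λ x → opBounded (p + r) j + 2 * x) (withP-large r) ⟩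
      opBounded (p + r) j + 2 * (opBounded r j + withP r)
        ≡⟨ cong (opBounded (p + r) j +_) (regroup (opBounded r j) (withP r)) ⟩
      opBounded (p + r) j + (opBounded r j + (opBounded r j + 2 * withP r))
        ≡⟨ cong (λ x → opBounded (p + r) j + (opBounded r j + x)) (opBounded-suc r) ⟨
      opBounded (p + r) j + (opBounded r j + opBounded r (suc j)) ∎
      where
      regroup : ∀ a b → 2 * (a + b) ≡ a + (a + 2 * b)
      regroup a b = ℕ-Solver.solve (a ∷ b ∷ [])

  opBounded-stable : ∀ n j → n ≤ j → opBounded n j ≡ pbarO n
  opBounded-stable zero    zero    z≤n = refl
  opBounded-stable n       (suc j) n≤1+j with ℕ.m≤n⇒m<n∨m≡n n≤1+j
  ... | inj₂ n≡1+j     = cong (opBounded n) (≡.sym n≡1+j)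
  ... | inj₁ (s≤s n≤j) = ≡.trans (LargestPart.opBounded-below j n (ℕ.≤-<-trans n≤j j<p)) (opBounded-stable n j n≤j)
    where
    j<p : j < LargestPart.p j
    j<p = ≡.subst (j <_) (ℕ.+-comm 1 (2 * j)) (s≤s (ℕ.m≤m+n j (j + 0)))

module SeriesIdentity where
  open import Data.Integer using (+_)
  open import Defs
  open PowerSeries
  open Overpartitions using (≤ᵇ-suc; module LargestPart; opBounded-stable)

  open RawRingDefinitions _⊕_ _⊛_ ⊖_ 𝟘 𝟙 using (_^_; 2#; thetaPartial; module JacobiTriple)

  module Precision (M : ℕ) where
    open Truncated M public using (truncatedRing; ≗⇒≈)
    open CommutativeRing truncatedRing public hiding (zero)
    open RingLemmas truncatedRing public hiding (_^_; 2#; thetaPartial; module JacobiTriple)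
    open import Relation.Binary.Reasoning.Setoid setoid public

  X : Series
  X zero    = + 0
  X (suc n) = 𝟙 n

  shift : ℕ → Series → Series
  shift zero    f         = f
  shift (suc a) f zero    = + 0
  shift (suc a) f (suc n) = shift a f n

  shift-< : ∀ a f n → n < a → shift a f n ≡ + 0
  shift-< (suc a) f zero    _           = ≡.refl
  shift-< (suc a) f (suc n) (s≤s n<a)   = shift-< a f n n<a

  shift-+ : ∀ a f m → shift a f (a ℕ.+ m) ≡ f m
  shift-+ zero    f m = ≡.refl
  shift-+ (suc a) f m = shift-+ a f m

  X-⊛ : ∀ f → X ⊛ f ≗ shift 1 f
  X-⊛ f zero    = ≡.refl
  X-⊛ f (suc n) = ≡.trans (ℤ.+-identityˡ _) (𝟙-⊛ f n)

  X^-⊛ : ∀ a f → X ^ a ⊛ f ≗ shift a f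
  X^-⊛ zero    f n = 𝟙-⊛ f n
  X^-⊛ (suc a) f n = ≡.trans (⊛-assoc X (X ^ a) f n) (≡.trans (X-⊛ (X ^ a ⊛ f) n) (shifted n))
    where
    shifted : shift 1 (X ^ a ⊛ f) ≗ shift (suc a) f
    shifted zero    = ≡.refl
    shifted (suc n) = X^-⊛ a f n

  X^-coefficient : ∀ a → X ^ a ≗ shift a 𝟙
  X^-coefficient a n = ≡.trans (≡.sym (≡.trans (⊛-comm (X ^ a) 𝟙 n) (𝟙-⊛ (X ^ a) n))) (X^-⊛ a 𝟙 n)

  X^-vanishes : ∀ M a → M ≤ a → X ^ a ≈[ M ] 𝟘
  X^-vanishes M a M≤a n n<M = ≡.trans (X^-coefficient a n) (shift-< a 𝟙 n (ℕ.<-≤-trans n<M M≤a))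

  X^-cancel : ∀ a {f g} → X ^ a ⊛ f ≗ X ^ a ⊛ g → f ≗ g
  X^-cancel a {f} {g} eq m = begin
    f m                     ≡⟨ shift-+ a f m ⟨
    shift a f (a ℕ.+ m)     ≡⟨ X^-⊛ a f (a ℕ.+ m) ⟨
    (X ^ a ⊛ f) (a ℕ.+ m)   ≡⟨ eq (a ℕ.+ m) ⟩
    (X ^ a ⊛ g) (a ℕ.+ m)   ≡⟨ X^-⊛ a g (a ℕ.+ m) ⟩
    shift a g (a ℕ.+ m)     ≡⟨ shift-+ a g m ⟩
    g m                     ∎
    where open ≡.≡-Reasoning

  exact : ∀ {f g} → (∀ M → f ≈[ M ] g) → f ≗ g
  exact f≈g n = f≈g (suc n) n (ℕ.n<1+n n)

  square-distance : ∀ t j → t ℕ.* t ℕ.+ j ℕ.* j ≡ 2 ℕ.* t ℕ.* j ℕ.+ ∣ t - j ∣ ℕ.* ∣ t - j ∣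
  square-distance t j with ℕ.≤-total t j
  ... | inj₁ t≤j = ≡.subst (λ d → t ℕ.* t ℕ.+ j ℕ.* j ≡ 2 ℕ.* t ℕ.* j ℕ.+ d ℕ.* d)
                     (≡.sym (ℕ.m≤n⇒∣m-n∣≡n∸m t≤j)) (below t (j ∸ t) j (ℕ.m+[n∸m]≡n t≤j))
    where
    below : ∀ t k j → t ℕ.+ k ≡ j → t ℕ.* t ℕ.+ j ℕ.* j ≡ 2 ℕ.* t ℕ.* j ℕ.+ k ℕ.* k
    below t k .(t ℕ.+ k) ≡.refl = ℕ-Solver.solve (t ∷ k ∷ [])
  ... | inj₂ j≤t = ≡.subst (λ d → t ℕ.* t ℕ.+ j ℕ.* j ≡ 2 ℕ.* t ℕ.* j ℕ.+ d ℕ.* d)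
                     (≡.sym (ℕ.m≤n⇒∣n-m∣≡n∸m j≤t)) (above t (t ∸ j) j (ℕ.m+[n∸m]≡n j≤t))
    where
    above : ∀ t k j → j ℕ.+ k ≡ t → t ℕ.* t ℕ.+ j ℕ.* j ≡ 2 ℕ.* t ℕ.* j ℕ.+ k ℕ.* k
    above .(j ℕ.+ k) k j ≡.refl = ℕ-Solver.solve (j ∷ k ∷ [])

  ∣t-2N∣≤N⇒N≤t : ∀ N t → ∣ t - (N ℕ.+ N) ∣ ≤ N → N ≤ t
  ∣t-2N∣≤N⇒N≤t N t k≤N = ℕ.+-cancelʳ-≤ N N t (begin
    N ℕ.+ N                       ≤⟨ ℕ.m≤n+∣n-m∣ (N ℕ.+ N) t ⟩
    t ℕ.+ ∣ t - (N ℕ.+ N) ∣       ≤⟨ ℕ.+-monoʳ-≤ t k≤N ⟩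
    t ℕ.+ N                       ∎)
    where open ℕ.≤-Reasoning

  ∣t-2N∣≤N⇒N<4N∸i : ∀ N t → ∣ t - (N ℕ.+ N) ∣ ≤ N → ∀ i → i < t → N < 2 ℕ.* (N ℕ.+ N) ∸ i
  ∣t-2N∣≤N⇒N<4N∸i N t k≤N i i<t = ℕ.m+n≤o⇒m≤o∸n (suc N) (begin
    suc N ℕ.+ i                            ≡⟨ ℕ.+-suc N i ⟨
    N ℕ.+ suc i                            ≤⟨ ℕ.+-monoʳ-≤ N i<t ⟩
    N ℕ.+ t                                ≤⟨ ℕ.+-monoʳ-≤ N (ℕ.m≤n+∣m-n∣ t (N ℕ.+ N)) ⟩
    N ℕ.+ ((N ℕ.+ N) ℕ.+ ∣ t - (N ℕ.+ N) ∣) ≤⟨ ℕ.+-monoʳ-≤ N (ℕ.+-monoʳ-≤ (N ℕ.+ N) k≤N) ⟩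
    N ℕ.+ ((N ℕ.+ N) ℕ.+ N)                ≡⟨ ℕ-Solver.solve (N ∷ []) ⟩
    2 ℕ.* (N ℕ.+ N)                        ∎)
    where open ℕ.≤-Reasoning

  m≤s*[m*m] : ∀ s .{{_ : NonZero s}} m → m ≤ s ℕ.* (m ℕ.* m)
  m≤s*[m*m] s zero    = z≤n
  m≤s*[m*m] s (suc m) = ℕ.≤-trans (ℕ.m≤m*n (suc m) (suc m)) (ℕ.m≤n*m (suc m ℕ.* suc m) s)

  module Scale (Q : Series) (s : ℕ) .{{_ : NonZero s}}
               (Q^-vanishes : ∀ M e → M ≤ s ℕ.* e → Q ^ e ≈[ M ] 𝟘)
               (Q^-cancel : ∀ e {f g} → Q ^ e ⊛ f ≗ Q ^ e ⊛ g → f ≗ g) where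
    open JacobiTriple Q

    coeff-exact : ∀ J t → evenPoch t ⊛ coeff J t ≗ Q ^ (∣ t - J ∣ ℕ.* ∣ t - J ∣) ⊛ descending (2 ℕ.* J) t
    coeff-exact J t = Q^-cancel (2 ℕ.* t ℕ.* J) (exact λ M → let open Precision M in begin
      Q ^ (2 ℕ.* t ℕ.* J) ⊛ (evenPoch t ⊛ coeff J t)          ≈⟨ JacobiTripleProduct.coeff-closed-form Q J t ⟩
      Q ^ (t ℕ.* t ℕ.+ J ℕ.* J) ⊛ descending (2 ℕ.* J) t      ≈⟨ *-congʳ (trans (^-congʳ Q (square-distance t J))
                                                                                (^-+ Q (2 ℕ.* t ℕ.* J) k²)) ⟩
      Q ^ (2 ℕ.* t ℕ.* J) ⊛ Q ^ k² ⊛ descending (2 ℕ.* J) t   ≈⟨ *-assoc _ _ _ ⟩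
      Q ^ (2 ℕ.* t ℕ.* J) ⊛ (Q ^ k² ⊛ descending (2 ℕ.* J) t) ∎)
      where
      k² : ℕ
      k² = ∣ t - J ∣ ℕ.* ∣ t - J ∣

    module Modulo (N : ℕ) where
      open Precision (suc N)
      open JacobiTripleProduct Q using (evenPoch-+; product-expansion)
      open import Algebra.Properties.CommutativeSemigroup *-commutativeSemigroup using (x∙yz≈y∙xz)

      J : ℕ
      J = N ℕ.+ N

      Q^-small : ∀ e → N < s ℕ.* e → Q ^ e ≈ 0#
      Q^-small e = Q^-vanishes (suc N) e

      factor≈1 : ∀ {x y} → x ≈ 0# → y ≈ 1# → (1# - x * x) * y ≈ 1#
      factor≈1 {x} {y} x≈0 y≈1 = begin
        (1# - x * x) * y     ≈⟨ *-cong (1-cong (*-congˡ x≈0)) y≈1 ⟩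
        (1# - x * 0#) * 1#   ≈⟨ solve 1 (λ x → (:1 :- x :* con (+ 0)) :* :1 := :1) refl x ⟩
        1#                   ∎

      evenPochFrom≈1 : ∀ t → N ≤ t → ∀ n → evenPochFrom t n ≈ 1#
      evenPochFrom≈1 t N≤t zero    = refl
      evenPochFrom≈1 t N≤t (suc n) = factor≈1 (Q^-small (suc (t ℕ.+ n)) N<s[1+t+n]) (evenPochFrom≈1 t N≤t n)
        where
        N<s[1+t+n] : N < s ℕ.* suc (t ℕ.+ n)
        N<s[1+t+n] = ℕ.≤-trans (s≤s (ℕ.≤-trans N≤t (ℕ.m≤m+n t n))) (ℕ.m≤n*m (suc (t ℕ.+ n)) s)

      descending≈1 : ∀ m t → (∀ i → i < t → N < m ∸ i) → descending m t ≈ 1#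
      descending≈1 m zero    _      = refl
      descending≈1 m (suc t) N<m∸i =
        factor≈1 (Q^-small (m ∸ t) (ℕ.≤-trans (N<m∸i t ℕ.≤-refl) (ℕ.m≤n*m (m ∸ t) s)))
                 (descending≈1 m t (λ i i<t → N<m∸i i (ℕ.m≤n⇒m≤1+n i<t)))

      termwise : ∀ t → t ≤ 2 ℕ.* J → evenPoch (2 ℕ.* J) ⊛ coeff J t ≈ Q ^ (∣ t - J ∣ ℕ.* ∣ t - J ∣)
      termwise t t≤2J = begin
        evenPoch (2 ℕ.* J) ⊛ coeff J t                 ≡⟨ cong (λ m → evenPoch m ⊛ coeff J t) 2J≡t+r ⟩
        evenPoch (t ℕ.+ r) ⊛ coeff J t                 ≈⟨ *-congʳ (evenPoch-+ t r) ⟩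
        evenPoch t ⊛ evenPochFrom t r ⊛ coeff J t      ≈⟨ solve 3 (λ a b c → a :* b :* c := b :* (a :* c)) refl _ _ _ ⟩
        evenPochFrom t r ⊛ (evenPoch t ⊛ coeff J t)    ≈⟨ *-congˡ (≗⇒≈ (coeff-exact J t)) ⟩
        evenPochFrom t r ⊛ (Q ^ k² ⊛ F)                ≈⟨ drop-factors ⟩
        Q ^ k²                                         ∎
        where
        r k k² : ℕ
        r = 2 ℕ.* J ∸ t
        2J≡t+r : 2 ℕ.* J ≡ t ℕ.+ r
        2J≡t+r = ≡.sym (ℕ.m+[n∸m]≡n t≤2J)
        k = ∣ t - J ∣
        k² = k ℕ.* k
        F : Series
        F = descending (2 ℕ.* J) t
        -- Either Q^(k²) already vanishes modulo q^(N+1), or k ≤ N and then every factor of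
        -- evenPochFrom t r and of F is 1 modulo q^(N+1).
        drop-factors : evenPochFrom t r ⊛ (Q ^ k² ⊛ F) ≈ Q ^ k²
        drop-factors with s ℕ.* k² ℕ.≤? N
        ... | no  s·k²≰N = begin
          evenPochFrom t r ⊛ (Q ^ k² ⊛ F)   ≈⟨ *-congˡ (*-congʳ Q^k²≈0) ⟩
          evenPochFrom t r ⊛ (0# ⊛ F)       ≈⟨ solve 2 (λ a b → a :* (con (+ 0) :* b) := con (+ 0)) refl _ F ⟩
          0#                                ≈⟨ Q^k²≈0 ⟨
          Q ^ k²                            ∎
          where
          Q^k²≈0 : Q ^ k² ≈ 0#
          Q^k²≈0 = Q^-small k² (ℕ.≰⇒> s·k²≰N)
        ... | yes s·k²≤N = begin
          evenPochFrom t r ⊛ (Q ^ k² ⊛ F)   ≈⟨ *-cong (evenPochFrom≈1 t (∣t-2N∣≤N⇒N≤t N t k≤N) r)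
                                                      (*-congˡ (descending≈1 (2 ℕ.* J) t (∣t-2N∣≤N⇒N<4N∸i N t k≤N))) ⟩
          1# ⊛ (Q ^ k² ⊛ 1#)                ≈⟨ solve 1 (λ a → :1 :* (a :* :1) := a) refl _ ⟩
          Q ^ k²                            ∎
          where
          k≤N : k ≤ N
          k≤N = ℕ.≤-trans (m≤s*[m*m] s k) s·k²≤N

      theta-expansion : ∀ z → z ⊛ z ≈ 1# →
                        evenPoch (2 ℕ.* J) ⊛ product z J ≈ 1# + 2# ⊛ thetaPartial z (λ k → Q ^ (k ℕ.* k)) J
      theta-expansion z zz = begin
        evenPoch (2 ℕ.* J) ⊛ product z J
          ≈⟨ *-congˡ (product-expansion z J (suc (2 ℕ.* J)) ℕ.≤-refl) ⟨
        evenPoch (2 ℕ.* J) ⊛ ∑ (suc (2 ℕ.* J)) (λ t → z ^ t ⊛ coeff J t)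
          ≈⟨ ∑-*ˡ (suc (2 ℕ.* J)) _ (λ t → z ^ t ⊛ coeff J t) ⟨
        ∑ (suc (2 ℕ.* J)) (λ t → evenPoch (2 ℕ.* J) ⊛ (z ^ t ⊛ coeff J t))
          ≈⟨ ∑-cong (suc (2 ℕ.* J)) (λ t t≤2J → trans (x∙yz≈y∙xz _ (z ^ t) _)
                                                    (*-congˡ (termwise t (ℕ.≤-pred t≤2J)))) ⟩
        ∑ (suc (2 ℕ.* J)) (λ t → z ^ t ⊛ Q ^ (∣ t - J ∣ ℕ.* ∣ t - J ∣))
          ≈⟨ theta-fold z zz (λ k → Q ^ (k ℕ.* k)) J ⟩
        z ^ J ⊛ (1# + 2# ⊛ θ)
          ≈⟨ *-congʳ (trans (^-+ z N N) (^-square-one zz N)) ⟩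
        1# ⊛ (1# + 2# ⊛ θ)
          ≈⟨ *-identityˡ _ ⟩
        1# + 2# ⊛ θ ∎
        where
        θ : Series
        θ = thetaPartial z (λ k → Q ^ (k ℕ.* k)) J

      evenPoch-halve : evenPoch (2 ℕ.* J) ≈ evenPoch J
      evenPoch-halve = begin
        evenPoch (2 ℕ.* J)                ≡⟨ cong (λ m → evenPoch (J ℕ.+ m)) (ℕ.+-identityʳ J) ⟩
        evenPoch (J ℕ.+ J)                ≈⟨ evenPoch-+ J J ⟩
        evenPoch J ⊛ evenPochFrom J J     ≈⟨ *-congˡ (evenPochFrom≈1 J (ℕ.m≤m+n N N) J) ⟩
        evenPoch J ⊛ 1#                   ≈⟨ *-identityʳ _ ⟩
        evenPoch J                        ∎

      theta-stable : ∀ z → thetaPartial z (λ k → Q ^ (k ℕ.* k)) J ≈ thetaPartial z (λ k → Q ^ (k ℕ.* k)) N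
      theta-stable z = thetaPartial-stable z (λ k → Q ^ (k ℕ.* k)) N
        (λ k N<k → Q^-small (k ℕ.* k) (ℕ.<-≤-trans N<k (m≤s*[m*m] s k))) N

  XX : Series
  XX = X ⊛ X

  XX^≗X^[2e] : ∀ e → XX ^ e ≗ X ^ (2 ℕ.* e)
  XX^≗X^[2e] e = exact (λ M → Precision.^-square M X e)

  XX^-⊛ : ∀ e f → XX ^ e ⊛ f ≗ shift (2 ℕ.* e) f
  XX^-⊛ e f n = ≡.trans (⊛-cong-≤ n (λ i _ → XX^≗X^[2e] e i) (λ _ _ → ≡.refl)) (X^-⊛ (2 ℕ.* e) f n)

  X-vanishes : ∀ M e → M ≤ 1 ℕ.* e → X ^ e ≈[ M ] 𝟘
  X-vanishes M e M≤e = X^-vanishes M e (≡.subst (M ≤_) (ℕ.*-identityˡ e) M≤e)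

  XX-vanishes : ∀ M e → M ≤ 2 ℕ.* e → XX ^ e ≈[ M ] 𝟘
  XX-vanishes M e M≤2e n n<M = ≡.trans (XX^≗X^[2e] e n) (X^-vanishes M (2 ℕ.* e) M≤2e n n<M)

  XX-cancel : ∀ e {f g} → XX ^ e ⊛ f ≗ XX ^ e ⊛ g → f ≗ g
  XX-cancel e {f} {g} eq = X^-cancel (2 ℕ.* e) λ n → begin
    (X ^ (2 ℕ.* e) ⊛ f) n   ≡⟨ X^-⊛ (2 ℕ.* e) f n ⟩
    shift (2 ℕ.* e) f n     ≡⟨ XX^-⊛ e f n ⟨
    (XX ^ e ⊛ f) n          ≡⟨ eq n ⟩
    (XX ^ e ⊛ g) n          ≡⟨ XX^-⊛ e g n ⟩
    shift (2 ℕ.* e) g n     ≡⟨ X^-⊛ (2 ℕ.* e) g n ⟨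
    (X ^ (2 ℕ.* e) ⊛ g) n   ∎
    where open ≡.≡-Reasoning

  module Scale₁ = Scale X  1 X-vanishes  X^-cancel
  module Scale₂ = Scale XX 2 XX-vanishes XX-cancel

  T : Series
  T n = + pbarO n

  O : ℕ → Series
  O j n = + opBounded n j

  O-zero : O 0 ≗ 𝟙
  O-zero zero    = ≡.refl
  O-zero (suc n) = ≡.refl

  O-suc : ∀ j → O (suc j) ≗ O j ⊕ X ^ suc (2 ℕ.* j) ⊛ (O j ⊕ O (suc j))
  O-suc j n = ≡.trans (by-size n) (cong (λ x → O j n ℤ.+ x) (≡.sym (X^-⊛ p g n)))
    where
    open LargestPart j using (opBounded-below; opBounded-above)
    p : ℕ
    p = suc (2 ℕ.* j)
    p≡ : LargestPart.p j ≡ p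
    p≡ = ℕ.+-comm (2 ℕ.* j) 1
    g : Series
    g = O j ⊕ O (suc j)
    above : ∀ r → O (suc j) (p ℕ.+ r) ≡ O j (p ℕ.+ r) ℤ.+ g r
    above r = cong +_ (≡.subst (λ p → opBounded (p ℕ.+ r) (suc j)
                                      ≡ opBounded (p ℕ.+ r) j ℕ.+ (opBounded r j ℕ.+ opBounded r (suc j)))
                               p≡ (opBounded-above r))
    by-size : ∀ n → O (suc j) n ≡ O j n ℤ.+ shift p g n
    by-size n with n ℕ.<? p
    ... | yes n<p = begin
      + opBounded n (suc j)    ≡⟨ cong +_ (opBounded-below n (≡.subst (n <_) (≡.sym p≡) n<p)) ⟩
      O j n                    ≡⟨ ℤ.+-identityʳ (O j n) ⟨
      O j n ℤ.+ + 0            ≡⟨ cong (λ x → O j n ℤ.+ x) (shift-< p g n n<p) ⟨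
      O j n ℤ.+ shift p g n    ∎
      where open ≡.≡-Reasoning
    ... | no n≮p = begin
      O (suc j) n                          ≡⟨ cong (O (suc j)) n≡p+r ⟩
      O (suc j) (p ℕ.+ r)                  ≡⟨ above r ⟩
      O j (p ℕ.+ r) ℤ.+ g r                ≡⟨ cong₂ (λ m x → O j m ℤ.+ x) n≡p+r (shift-+ p g r) ⟨
      O j n ℤ.+ shift p g (p ℕ.+ r)        ≡⟨ cong (λ m → O j n ℤ.+ shift p g m) n≡p+r ⟨
      O j n ℤ.+ shift p g n                ∎
      where
      open ≡.≡-Reasoning
      r : ℕ
      r = n ∸ p
      n≡p+r : n ≡ p ℕ.+ r
      n≡p+r = ≡.sym (ℕ.m+[n∸m]≡n (ℕ.≮⇒≥ n≮p))

  T≈O : ∀ N J → N ≤ J → T ≈[ suc N ] O J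
  T≈O N J N≤J n n≤N = cong +_ (≡.sym (opBounded-stable n J (ℕ.≤-trans (ℕ.≤-pred n≤N) N≤J)))

  θ₁ θ₂ : ℕ → Series
  θ₁ = thetaPartial 𝟙 (λ k → X ^ (k ℕ.* k))
  θ₂ = thetaPartial (⊖ 𝟙) (λ k → XX ^ (k ℕ.* k))

  main-identity : ∀ N → (𝟙 ⊕ 2# ⊛ θ₂ N) ⊛ T ≈[ suc N ] 𝟙 ⊕ 2# ⊛ θ₁ N
  main-identity N = begin
    (1# + 2# ⊛ θ₂ N) ⊛ T
      ≈⟨ *-cong (+-congˡ {1#} (*-congˡ {2#} (sym (M₂.theta-stable (- 1#))))) (T≈O N J (ℕ.m≤m+n N N)) ⟩
    (1# + 2# ⊛ θ₂ J) ⊛ O J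
      ≈⟨ *-congʳ (M₂.theta-expansion (- 1#) −1*−1≈1) ⟨
    E₂.evenPoch (2 ℕ.* J) ⊛ E₂.product (- 1#) J ⊛ O J
      ≈⟨ *-congʳ (*-cong M₂.evenPoch-halve (trans (J₂.product-at-−1 J) (trans (*-congʳ −1^J≈1) (*-identityˡ _)))) ⟩
    E₂.evenPoch J ⊛ (E₂.oddPoch⁻ J ⊛ E₂.oddPoch⁻ J) ⊛ O J
      ≈⟨ solve 3 (λ e w o → e :* (w :* w) :* o := e :* w :* (w :* o)) refl (E₂.evenPoch J) (E₂.oddPoch⁻ J) (O J) ⟩
    E₂.evenPoch J ⊛ E₂.oddPoch⁻ J ⊛ (E₂.oddPoch⁻ J ⊛ O J)
      ≈⟨ *-cong (sym (Squaring.evenPoch-square J)) (*-congʳ (Squaring.oddPoch⁻-square J)) ⟩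
    E₁.evenPoch (2 ℕ.* J) ⊛ (E₁.oddPoch⁻ J ⊛ E₁.oddPoch⁺ J ⊛ O J)
      ≈⟨ *-congˡ (solve 3 (λ a b o → a :* b :* o := b :* (o :* a)) refl (E₁.oddPoch⁻ J) (E₁.oddPoch⁺ J) (O J)) ⟩
    E₁.evenPoch (2 ℕ.* J) ⊛ (E₁.oddPoch⁺ J ⊛ (O J ⊛ E₁.oddPoch⁻ J))
      ≈⟨ *-congˡ (*-congˡ (J₁.oddPoch-ratio O (≗⇒≈ O-zero) (λ j → ≗⇒≈ (O-suc j)) J)) ⟩
    E₁.evenPoch (2 ℕ.* J) ⊛ (E₁.oddPoch⁺ J ⊛ E₁.oddPoch⁺ J)
      ≈⟨ *-congˡ (J₁.product-at-1 J) ⟨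
    E₁.evenPoch (2 ℕ.* J) ⊛ E₁.product 1# J
      ≈⟨ M₁.theta-expansion 1# (*-identityˡ 1#) ⟩
    1# + 2# ⊛ θ₁ J
      ≈⟨ +-congˡ {1#} (*-congˡ {2#} (M₁.theta-stable 1#)) ⟩
    1# + 2# ⊛ θ₁ N ∎
    where
    open Precision (suc N)
    open import Algebra.Properties.Ring (CommutativeRing.ring truncatedRing) using (-1*x≈-x; -‿involutive)
    module M₁ = Scale₁.Modulo N
    module M₂ = Scale₂.Modulo N
    module E₁ = JacobiTriple X
    module E₂ = JacobiTriple XX
    module J₁ = JacobiTripleProduct X
    module J₂ = JacobiTripleProduct XX
    module Squaring = JacobiTripleSquaring X
    J : ℕ
    J = N ℕ.+ N
    −1*−1≈1 : - 1# ⊛ - 1# ≈ 1#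
    −1*−1≈1 = trans (-1*x≈-x (- 1#)) (-‿involutive 1#)
    −1^J≈1 : (- 1#) ^ J ≈ 1#
    −1^J≈1 = trans (^-+ (- 1#) N N) (^-square-one −1*−1≈1 N)

  2#-⊛ : ∀ g → 2# ⊛ g ≗ g ⊕ g
  2#-⊛ g n = ≡.trans (⊛-distribʳ-⊕ 𝟙 𝟙 g n) (cong₂ ℤ._+_ (𝟙-⊛ g n) (𝟙-⊛ g n))

  sign^-⊛ : ∀ m g n → ((⊖ 𝟙) ^ m ⊛ g) n ≡ signPow m ℤ.* g n
  sign^-⊛ zero    g n = ≡.trans (𝟙-⊛ g n) (≡.sym (ℤ.*-identityˡ (g n)))
  sign^-⊛ (suc m) g n = begin
    ((⊖ 𝟙 ⊛ (⊖ 𝟙) ^ m) ⊛ g) n    ≡⟨ ⊛-assoc (⊖ 𝟙) ((⊖ 𝟙) ^ m) g n ⟩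
    (⊖ 𝟙 ⊛ ((⊖ 𝟙) ^ m ⊛ g)) n    ≡⟨ ⊖-⊛ 𝟙 _ n ⟩
    ℤ.- (𝟙 ⊛ ((⊖ 𝟙) ^ m ⊛ g)) n  ≡⟨ cong ℤ.-_ (𝟙-⊛ _ n) ⟩
    ℤ.- ((⊖ 𝟙) ^ m ⊛ g) n        ≡⟨ cong ℤ.-_ (sign^-⊛ m g n) ⟩
    ℤ.- (signPow m ℤ.* g n)      ≡⟨ ℤ.neg-distribˡ-* (signPow m) (g n) ⟩
    signPow (suc m) ℤ.* g n      ∎
    where open ≡.≡-Reasoning

  𝟙^-⊛ : ∀ m g → 𝟙 ^ m ⊛ g ≗ g
  𝟙^-⊛ zero    g n = 𝟙-⊛ g n
  𝟙^-⊛ (suc m) g n = ≡.trans (⊛-assoc 𝟙 (𝟙 ^ m) g n) (≡.trans (𝟙-⊛ _ n) (𝟙^-⊛ m g n))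

  shift-T : ∀ a n → shift a T n ≡ + pbarOShift n a
  shift-T zero    n       = ≡.refl
  shift-T (suc a) zero    = ≡.refl
  shift-T (suc a) (suc n) =
    ≡.trans (shift-T a n) (cong (λ b → + (if b then pbarO (n ∸ a) else 0)) (≡.sym (≤ᵇ-suc a n)))

  altSum-coefficient : ∀ n c → altSum n c ≡ (θ₂ c ⊛ T) n
  altSum-coefficient n zero    = ≡.sym (𝟘-⊛ T n)
  altSum-coefficient n (suc c) = begin
    altSum n c ℤ.+ signPow (suc c) ℤ.* + pbarOShift n (2 ℕ.* k²)
      ≡⟨ cong₂ ℤ._+_ (altSum-coefficient n c) (cong (signPow (suc c) ℤ.*_) (≡.sym XX^k²-coefficient)) ⟩
    (θ₂ c ⊛ T) n ℤ.+ signPow (suc c) ℤ.* (XX ^ k² ⊛ T) n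
      ≡⟨ cong (λ x → (θ₂ c ⊛ T) n ℤ.+ x) (sign^-⊛ (suc c) (XX ^ k² ⊛ T) n) ⟨
    (θ₂ c ⊛ T) n ℤ.+ ((⊖ 𝟙) ^ suc c ⊛ (XX ^ k² ⊛ T)) n
      ≡⟨ cong (λ x → (θ₂ c ⊛ T) n ℤ.+ x) (⊛-assoc ((⊖ 𝟙) ^ suc c) (XX ^ k²) T n) ⟨
    (θ₂ c ⊛ T) n ℤ.+ ((⊖ 𝟙) ^ suc c ⊛ XX ^ k² ⊛ T) n
      ≡⟨ ⊛-distribʳ-⊕ (θ₂ c) ((⊖ 𝟙) ^ suc c ⊛ XX ^ k²) T n ⟨
    (θ₂ (suc c) ⊛ T) n ∎
    where
    open ≡.≡-Reasoning
    k² : ℕ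
    k² = suc c ℕ.* suc c
    XX^k²-coefficient : (XX ^ k² ⊛ T) n ≡ + pbarOShift n (2 ℕ.* k²)
    XX^k²-coefficient = ≡.trans (XX^-⊛ k² T n) (shift-T (2 ℕ.* k²) n)

  lhs-coefficient : ∀ n → lhs n ≡ ((𝟙 ⊕ 2# ⊛ θ₂ n) ⊛ T) n
  lhs-coefficient n = begin
    + pbarO n ℤ.+ + 2 ℤ.* altSum n n
      ≡⟨ cong₂ ℤ._+_ (𝟙-⊛ T n) (double (altSum n n)) ⟨
    (𝟙 ⊛ T) n ℤ.+ (altSum n n ℤ.+ altSum n n)
      ≡⟨ cong (λ x → (𝟙 ⊛ T) n ℤ.+ x) (cong₂ ℤ._+_ (altSum-coefficient n n) (altSum-coefficient n n)) ⟩
    (𝟙 ⊛ T) n ℤ.+ ((θ₂ n ⊛ T) n ℤ.+ (θ₂ n ⊛ T) n)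
      ≡⟨ cong (λ x → (𝟙 ⊛ T) n ℤ.+ x) (2#-⊛ (θ₂ n ⊛ T) n) ⟨
    (𝟙 ⊛ T) n ℤ.+ (2# ⊛ (θ₂ n ⊛ T)) n
      ≡⟨ cong (λ x → (𝟙 ⊛ T) n ℤ.+ x) (⊛-assoc 2# (θ₂ n) T n) ⟨
    (𝟙 ⊛ T) n ℤ.+ (2# ⊛ θ₂ n ⊛ T) n
      ≡⟨ ⊛-distribʳ-⊕ 𝟙 (2# ⊛ θ₂ n) T n ⟨
    ((𝟙 ⊕ 2# ⊛ θ₂ n) ⊛ T) n ∎
    where
    open ≡.≡-Reasoning
    double : ∀ a → a ℤ.+ a ≡ + 2 ℤ.* a
    double = ℤ-Solver.solve-∀

  shift-𝟙-≢ : ∀ e n → n ≢ e → shift e 𝟙 n ≡ + 0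
  shift-𝟙-≢ zero    zero    n≢e = ⊥-elim (n≢e ≡.refl)
  shift-𝟙-≢ zero    (suc n) n≢e = ≡.refl
  shift-𝟙-≢ (suc e) zero    n≢e = ≡.refl
  shift-𝟙-≢ (suc e) (suc n) n≢e = shift-𝟙-≢ e n (λ n≡e → n≢e (cong suc n≡e))

  shift-𝟙-≡ : ∀ e → shift e 𝟙 e ≡ + 1
  shift-𝟙-≡ zero    = ≡.refl
  shift-𝟙-≡ (suc e) = shift-𝟙-≡ e

  θ₁-suc : ∀ c n → θ₁ (suc c) n ≡ θ₁ c n ℤ.+ shift (suc c ℕ.* suc c) 𝟙 n
  θ₁-suc c n = cong (λ x → θ₁ c n ℤ.+ x)
                    (≡.trans (𝟙^-⊛ (suc c) (X ^ (suc c ℕ.* suc c)) n) (X^-coefficient (suc c ℕ.* suc c) n))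

  θ₁-nonsquare : ∀ n c → (∀ m → m < c → n ≢ suc m ℕ.* suc m) → θ₁ c n ≡ + 0
  θ₁-nonsquare n zero    _         = ≡.refl
  θ₁-nonsquare n (suc c) nonsquare = ≡.trans (θ₁-suc c n)
    (cong₂ ℤ._+_ (θ₁-nonsquare n c (λ m m<c → nonsquare m (ℕ.m≤n⇒m≤1+n m<c)))
                 (shift-𝟙-≢ _ n (nonsquare c ℕ.≤-refl)))

  square-< : ∀ {a b} → a < b → a ℕ.* a < b ℕ.* b
  square-< a<b = ℕ.*-mono-< a<b a<b

  θ₁-square : ∀ m c → m < c → θ₁ c (suc m ℕ.* suc m) ≡ + 1
  θ₁-square m (suc c) (s≤s m≤c) with ℕ.m≤n⇒m<n∨m≡n m≤c
  ... | inj₂ ≡.refl = ≡.trans (θ₁-suc m n) (cong₂ ℤ._+_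
          (θ₁-nonsquare n m (λ k k<m n≡k² → ℕ.<⇒≢ (square-< (s≤s k<m)) (≡.sym n≡k²))) (shift-𝟙-≡ n))
    where
    n : ℕ
    n = suc m ℕ.* suc m
  ... | inj₁ m<c    = ≡.trans (θ₁-suc c n) (cong₂ ℤ._+_
          (θ₁-square m c m<c) (shift-𝟙-≢ _ n (ℕ.<⇒≢ (square-< (s≤s m<c)))))
    where
    n : ℕ
    n = suc m ℕ.* suc m

  lhs≡1+2θ₁ : ∀ n → lhs n ≡ 𝟙 n ℤ.+ (θ₁ n n ℤ.+ θ₁ n n)
  lhs≡1+2θ₁ n = begin
    lhs n                                 ≡⟨ lhs-coefficient n ⟩
    ((𝟙 ⊕ 2# ⊛ θ₂ n) ⊛ T) n               ≡⟨ main-identity n n (ℕ.n<1+n n) ⟩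
    𝟙 n ℤ.+ (2# ⊛ θ₁ n) n                 ≡⟨ cong (λ x → 𝟙 n ℤ.+ x) (2#-⊛ (θ₁ n) n) ⟩
    𝟙 n ℤ.+ (θ₁ n n ℤ.+ θ₁ n n)           ∎
    where open ≡.≡-Reasoning

  lhs-square : ∀ m → lhs (suc m ℕ.* suc m) ≡ + 2
  lhs-square m = ≡.trans (lhs≡1+2θ₁ n) (cong (λ x → + 0 ℤ.+ (x ℤ.+ x)) (θ₁-square m n (ℕ.m≤m*n (suc m) (suc m))))
    where
    n : ℕ
    n = suc m ℕ.* suc m

  lhs-nonsquare : ∀ n → (∀ m → suc n ≢ suc m ℕ.* suc m) → lhs (suc n) ≡ + 0
  lhs-nonsquare n nonsquare = ≡.trans (lhs≡1+2θ₁ (suc n))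
    (cong (λ x → + 0 ℤ.+ (x ℤ.+ x)) (θ₁-nonsquare (suc n) (suc n) (λ m _ → nonsquare m)))

open import Defs
open import Data.Integer using (+_)
open import Data.Nat using (_*_)
open import Data.Product using (_×_; ∃)
open import Relation.Nullary using (¬_)
open SeriesIdentity using (lhs-square; lhs≡1+2θ₁; lhs-nonsquare)

theorem1p5 : (n : ℕ) →
    ((∃ λ m → n ≡ suc m * suc m) → lhs n ≡ + 2)
    × (n ≡ 0 → lhs n ≡ + 1)
    × (n ≢ 0 → ¬ (∃ λ m → n ≡ suc m * suc m) → lhs n ≡ + 0)
theorem1p5 n = (λ { (m , ≡.refl) → lhs-square m })
             , (λ { ≡.refl → lhs≡1+2θ₁ 0 })
             , nonzero-nonsquare n
  where
  nonzero-nonsquare : ∀ n → n ≢ 0 → ¬ (∃ λ m → n ≡ suc m * suc m) → lhs n ≡ + 0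
  nonzero-nonsquare zero    n≢0 _       = ⊥-elim (n≢0 ≡.refl)
  nonzero-nonsquare (suc n) _   ¬square = lhs-nonsquare n (λ m n≡m² → ¬square (m , n≡m²))
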